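{- Let $(S,x)$ be a solution of UnifFLPP with $x$ a minimum-cost assignment for $S$, let $(S^*,x^*)$ be an optimum solution, and fix a path decomposition $P$ as in the context. Then the linear program $$\min \sum_{s\in L,\ t\in (S^*\setminus S)\cup L}\hat c_{st}y_{st}$$ subject to $\sum_{t\in(S^*\setminus S)\cup L}y_{st}=1$ for all $s\in L$, $\sum_{s\in L}y_{st}\le1$ for all $t\in S^*\setminus S$, and $y_{st}\ge0$ for all $s\in L$, $t\in (S^*\setminus S)\cup L$, has a feasible (fractional) solution of cost at most $$2v(Sw(L,\cdot))+v(Tr(L,\cdot))+v(Pen(L))-c_f(L)+c_f(S^*\setminus S).$$
   Context: UnifFLPP: finite facility set $F$, finite client set $C$, metric distances $c_{ij}\ge0$ on $F\cup C$; facility $i$ has opening cost $f_i\ge0$ and capacity $U$ (same for all); client $j$ has demand $d_j\ge0$ and penalty $p_j\ge0$ per unit of unserved demand. A solution is $S\subseteq F$ with an assignment $x(i,j)\ge0$ ($i\in S$) satisfying $\sum_j x(i,j)\le U$ and $\sum_{i\in S}x(i,j)\le d_j$; cost $=\sum_{i\in S}f_i+\sum_{i,j}c_{ij}x(i,j)+\sum_j p_j(d_j-\sum_i x(i,j))$; $x$ is a minimum-cost assignment for $S$ if it minimizes this cost among assignments for $S$. For $A\subseteq F$, $c_f(A)=\sum_{i\in A}f_i$. Path decomposition: add a dummy facility $N$ to $S$ with $x(N,j)=d_j-\sum_{i\in S}x(i,j)$ and a dummy facility $N^*$ to $S^*$ with $x^*(N^*,j)=d_j-\sum_{i\in S^*}x^*(i,j)$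 (set $x(N^*,j)=x^*(N,j)=0$, $x(i,j)=0$ for $i\notin S$, $x^*(i,j)=0$ for $i\notin S^*$). On the bipartite graph between $F\cup\{N,N^*\}$ and $C$, the edge $(i,j)$ carries $x(i,j)-x^*(i,j)$ units from $i$ to $j$ (negative means from $j$ to $i$). Edge $(i,j)$ with $i\in F$ has unit cost $c_{ij}$; edges $(N,j)$, $(N^*,j)$ have unit cost $p_j$. Decompose this flow (after cancelling zero-cost cycles) into a set $P$ of weighted paths ($w(p)>0$), each from a vertex of $S\cup\{N\}$ to a vertex of $S^*\cup\{N^*\}$, the total weight on each edge equal to the absolute flow on it. $c(p)$ is the sum of unit costs of the edges of $p$; $w(P')=\sum_{p\in P'}w(p)$, $v(P')=\sum_{p\in P'}w(p)c(p)$. For $s\in S\setminus S^*$: $Sw(s,\cdot)$ = paths from $s$ ending in $S^*\setminus S$ (and $Sw(s,t)$ those ending at $t$); $Tr(s,\cdot)$ = paths from $s$ ending in $S\cap S^*$; $Pen(s)$ = paths from $s$ ending at $N^*$. For $A\subseteq S\setminus S^*$ these are extended by union over $s\in A$. A facility $s\in S\setminus S^*$ with $w(Sw(s,\cdot))>0$ is light if $w(Sw(s,\cdot))<U/2$; $L$ is the set of light facilities. For $s\in L$ let $N_s=U-\sum_j x(s,j)$ (unused capacity) and define $\theta(s)=0$ if $N_s\ge U/2$; $\theta(s)=\frac{v(Tr(s,\cdot))}{w(Tr(s,\cdot))}(U/2-N_s)/(U/2)$ if $N_s<U/2\le N_s+w(Tr(s,\cdot))$; and $\theta(s)=\big(v(Tr(s,\cdot))+\frac{v(Pen(s))}{w(Pen(s))}(U/2-N_s-w(Tr(s,\cdot)))\big)/(U/2)$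 otherwise. Costs: $\hat c_{st}=w(Sw(s,\cdot))c_{st}+f_t-f_s$ for $s\in L$, $t\in S^*\setminus S$; $\hat c_{st}=w(Sw(s,\cdot))(c_{st}+\theta(t))-f_s$ for $s,t\in L$, $t\ne s$; and $\hat c_{ss}=\infty$.
   Formalization: The distances $c_{ij}$, opening costs $f_i$, capacity $U$, demands $d_j$, penalties $p_j$, the assignments $x$, $x^*$ and the path weights are rational, and the linear program's solution is taken over the rationals. -}

module Defs where

open import Data.Nat using (ℕ; zero; suc)
open import Data.Fin using (Fin; zero; suc)
open import Data.Fin.Properties using () renaming (_≟_ to _≟F_)
open import Data.Bool using (Bool; true; false; if_then_else_; _∧_; _∨_; not)
open import Data.List using (List; []; _∷_)
open import Data.List.Relation.Unary.All using (All)
open import Data.Product using (_×_; _,_; proj₁; proj₂; Σ)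
open import Data.Sum using (_⊎_; inj₁; inj₂)
open import Data.Rational using (ℚ; 0ℚ; 1ℚ; ½; _+_; _*_; _-_; -_; _≤_; _<_; _÷_; ≢-nonZero)
open import Data.Rational.Properties using (_≟_; _≤?_; _<?_)
open import Relation.Nullary using (yes; no)
open import Relation.Nullary.Decidable using (⌊_⌋)
open import Relation.Binary.PropositionalEquality using (_≡_)

sumFin : {n : ℕ} → (Fin n → ℚ) → ℚ
sumFin {zero}  f = 0ℚ
sumFin {suc n} f = f zero + sumFin (λ i → f (suc i))

sumList : {A : Set} → (A → ℚ) → List A → ℚ
sumList f []       = 0ℚ
sumList f (a ∷ as) = f a + sumList f as

-- total division: a / b, and 0 when b = 0 (only used where b ≠ 0 in the paper)
_/'_ : ℚ → ℚ → ℚ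
a /' b with b ≟ 0ℚ
... | yes _   = 0ℚ
... | no b≢0  = _÷_ a b {{≢-nonZero b≢0}}

ifq : Bool → ℚ → ℚ
ifq b q = if b then q else 0ℚ

-- Instances of UnifFLPP.  Facilities are Fin nF, clients Fin nC.
-- Points of the metric space F ∪ C: inj₁ i (facility), inj₂ j (client).

Pt : ℕ → ℕ → Set
Pt nF nC = Fin nF ⊎ Fin nC

record IsMetric {X : Set} (c : X → X → ℚ) : Set where
  field
    nonneg : ∀ a b → 0ℚ ≤ c a b
    self   : ∀ a → c a a ≡ 0ℚ
    symm   : ∀ a b → c a b ≡ c b a
    tri    : ∀ a b e → c a e ≤ c a b + c b e

record Instance (nF nC : ℕ) : Set where
  field
    dist    : Pt nF nC → Pt nF nC → ℚ
    metric  : IsMetric dist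
    fcost   : Fin nF → ℚ
    fcost≥0 : ∀ i → 0ℚ ≤ fcost i
    U       : ℚ
    U≥0     : 0ℚ ≤ U
    dem     : Fin nC → ℚ
    dem≥0   : ∀ j → 0ℚ ≤ dem j
    pen     : Fin nC → ℚ
    pen≥0   : ∀ j → 0ℚ ≤ pen j

FSet : ℕ → Set
FSet nF = Fin nF → Bool

module _ {nF nC : ℕ} (I : Instance nF nC) where
  open Instance I

  cFC : Fin nF → Fin nC → ℚ
  cFC i j = dist (inj₁ i) (inj₂ j)

  cFF : Fin nF → Fin nF → ℚ
  cFF i t = dist (inj₁ i) (inj₁ t)

  cf : FSet nF → ℚ
  cf A = sumFin (λ i → ifq (A i) (fcost i))

  served : (Fin nF → Fin nC → ℚ) → Fin nC → ℚ
  served x j = sumFin (λ i → x i j)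

  record IsAssignment (S : FSet nF) (x : Fin nF → Fin nC → ℚ) : Set where
    field
      nonneg   : ∀ i j → 0ℚ ≤ x i j
      outside  : ∀ i j → S i ≡ false → x i j ≡ 0ℚ
      capacity : ∀ i → S i ≡ true → sumFin (x i) ≤ U
      demand   : ∀ j → served x j ≤ dem j

  cost : FSet nF → (Fin nF → Fin nC → ℚ) → ℚ
  cost S x = cf S
           + sumFin (λ i → sumFin (λ j → cFC i j * x i j))
           + sumFin (λ j → pen j * (dem j - served x j))

  IsMinCostAssignment : FSet nF → (Fin nF → Fin nC → ℚ) → Set
  IsMinCostAssignment S x =
    IsAssignment S x × (∀ x′ → IsAssignment S x′ → cost S x ≤ cost S x′)

  IsOptimalSolution : FSet nF → (Fin nF → Fin nC → ℚ) → Set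
  IsOptimalSolution S x =
    IsAssignment S x × (∀ S′ x′ → IsAssignment S′ x′ → cost S x ≤ cost S′ x′)

data FNode (nF : ℕ) : Set where
  fac   : Fin nF → FNode nF
  nodeN nodeN* : FNode nF

_==F_ : {n : ℕ} → Fin n → Fin n → Bool
i ==F j = ⌊ i ≟F j ⌋

_==N_ : {nF : ℕ} → FNode nF → FNode nF → Bool
fac i  ==N fac j  = i ==F j
nodeN  ==N nodeN  = true
nodeN* ==N nodeN* = true
_      ==N _      = false

-- A weighted path a₀ → j₁ → a₁ → j₂ → a₂ → … → j_k → a_k,
-- stored as its start a₀ and the list of steps (j_m , a_m).
record WPath (nF nC : ℕ) : Set where
  constructor wpath
  field
    start  : FNode nF
    steps  : List (Fin nC × FNode nF)
    weight : ℚ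
open WPath public

endFrom : {nF nC : ℕ} → FNode nF → List (Fin nC × FNode nF) → FNode nF
endFrom a []              = a
endFrom a ((_ , b) ∷ rest) = endFrom b rest

pathEnd : {nF nC : ℕ} → WPath nF nC → FNode nF
pathEnd q = endFrom (start q) (steps q)

-- number of traversals of edge (a,j) in direction a → j, resp. j → a
fwdCount : {nF nC : ℕ} → FNode nF → List (Fin nC × FNode nF) → FNode nF → Fin nC → ℚ
fwdCount prev []               a j = 0ℚ
fwdCount prev ((j′ , b) ∷ rest) a j = ifq ((prev ==N a) ∧ (j′ ==F j)) 1ℚ + fwdCount b rest a j

bwdCount : {nF nC : ℕ} → FNode nF → List (Fin nC × FNode nF) → FNode nF → Fin nC → ℚ
bwdCount prev []               a j = 0ℚ
bwdCount prev ((j′ , b) ∷ rest) a j = ifq ((b ==N a) ∧ (j′ ==F j)) 1ℚ + bwdCount b rest a j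

sumFNode : {nF : ℕ} → (FNode nF → ℚ) → ℚ
sumFNode g = sumFin (λ i → g (fac i)) + g nodeN + g nodeN*

module _ {nF nC : ℕ} (I : Instance nF nC) where
  open Instance I

  ucost : FNode nF → Fin nC → ℚ
  ucost (fac i) j = cFC I i j
  ucost nodeN   j = pen j
  ucost nodeN*  j = pen j

  pathCostFrom : FNode nF → List (Fin nC × FNode nF) → ℚ
  pathCostFrom prev []               = 0ℚ
  pathCostFrom prev ((j , b) ∷ rest) = ucost prev j + ucost b j + pathCostFrom b rest

  pathCost : WPath nF nC → ℚ
  pathCost q = pathCostFrom (start q) (steps q)

  -- flow x(a,j) - x*(a,j) on edge (a,j), with the dummy facilities N, N*
  flow : (Fin nF → Fin nC → ℚ) → (Fin nF → Fin nC → ℚ) → FNode nF → Fin nC → ℚ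
  flow x x* (fac i) j = x i j - x* i j
  flow x x* nodeN   j = dem j - served I x j
  flow x x* nodeN*  j = - (dem j - served I x* j)

  inSN : FSet nF → FNode nF → Bool
  inSN S (fac i) = S i
  inSN S nodeN   = true
  inSN S nodeN*  = false

  inSN* : FSet nF → FNode nF → Bool
  inSN* S (fac i) = S i
  inSN* S nodeN   = false
  inSN* S nodeN*  = true

  -- Path decomposition of the flow x - x* after cancelling (zero-cost) cycles:
  -- positive weights, paths from S ∪ {N} to S* ∪ {N*}, the paths use every
  -- edge only in the direction of the flow and with total weight at most the
  -- absolute flow, and the part of the flow not covered by the paths
  -- (the cancelled cycles) is a circulation.
  record IsPathDecomposition (S : FSet nF) (x : Fin nF → Fin nC → ℚ)
                             (S* : FSet nF) (x* : Fin nF → Fin nC → ℚ)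
                             (P : List (WPath nF nC)) : Set where
    fwdW : FNode nF → Fin nC → ℚ
    fwdW a j = sumList (λ q → weight q * fwdCount (start q) (steps q) a j) P
    bwdW : FNode nF → Fin nC → ℚ
    bwdW a j = sumList (λ q → weight q * bwdCount (start q) (steps q) a j) P
    residual : FNode nF → Fin nC → ℚ
    residual a j = flow x x* a j - (fwdW a j - bwdW a j)
    field
      positive  : All (λ q → 0ℚ < weight q) P
      starts    : All (λ q → inSN S (start q) ≡ true) P
      ends      : All (λ q → inSN* S* (pathEnd q) ≡ true) P
      conformP  : ∀ a j → 0ℚ ≤ flow x x* a j → bwdW a j ≡ 0ℚ × fwdW a j ≤ flow x x* a j
      conformN  : ∀ a j → flow x x* a j < 0ℚ → fwdW a j ≡ 0ℚ × bwdW a j ≤ - flow x x* a j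
      circClient : ∀ j → sumFNode (λ a → residual a j) ≡ 0ℚ
      circFac    : ∀ a → sumFin (residual a) ≡ 0ℚ

module Setup {nF nC : ℕ} (I : Instance nF nC)
             (S : FSet nF) (x : Fin nF → Fin nC → ℚ)
             (S* : FSet nF) (x* : Fin nF → Fin nC → ℚ)
             (P : List (WPath nF nC)) where
  open Instance I

  U/2 : ℚ
  U/2 = ½ * U

  SminusS* : FSet nF
  SminusS* i = S i ∧ not (S* i)

  S*minusS : FSet nF
  S*minusS i = S* i ∧ not (S i)

  SandS* : FSet nF
  SandS* i = S i ∧ S* i

  startsAt : Fin nF → WPath nF nC → Bool
  startsAt s q = start q ==N fac s

  endsIn : FSet nF → WPath nF nC → Bool
  endsIn A q with pathEnd q
  ... | fac t = A t
  ... | _     = false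

  endsAtN* : WPath nF nC → Bool
  endsAtN* q = pathEnd q ==N nodeN*

  inSw inTr inPen : Fin nF → WPath nF nC → Bool
  inSw  s q = SminusS* s ∧ startsAt s q ∧ endsIn S*minusS q
  inTr  s q = SminusS* s ∧ startsAt s q ∧ endsIn SandS* q
  inPen s q = SminusS* s ∧ startsAt s q ∧ endsAtN* q

  wOf vOf : (WPath nF nC → Bool) → ℚ
  wOf sel = sumList (λ q → ifq (sel q) (weight q)) P
  vOf sel = sumList (λ q → ifq (sel q) (weight q * pathCost I q)) P

  wSw wTr wPen vSw vTr vPen : Fin nF → ℚ
  wSw  s = wOf (inSw s)
  wTr  s = wOf (inTr s)
  wPen s = wOf (inPen s)
  vSw  s = vOf (inSw s)
  vTr  s = vOf (inTr s)
  vPen s = vOf (inPen s)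

  isLight : FSet nF
  isLight s = SminusS* s ∧ ⌊ 0ℚ <? wSw s ⌋ ∧ ⌊ wSw s <? U/2 ⌋

  inT : FSet nF
  inT t = S*minusS t ∨ isLight t

  Nfree : Fin nF → ℚ
  Nfree s = U - sumFin (x s)

  θ : Fin nF → ℚ
  θ s =
    if ⌊ U/2 ≤? Nfree s ⌋ then 0ℚ
    else if ⌊ U/2 ≤? Nfree s + wTr s ⌋
      then ((vTr s /' wTr s) * (U/2 - Nfree s)) /' U/2
      else (vTr s + (vPen s /' wPen s) * (U/2 - Nfree s - wTr s)) /' U/2

  -- ĉ_st for s ∈ L and t ∈ (S* \ S) ∪ L with t ≠ s  (ĉ_ss = ∞ is handled
  -- by forcing y_ss = 0 in the LP)
  chat : Fin nF → Fin nF → ℚ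
  chat s t =
    if S*minusS t
      then wSw s * cFF I s t + fcost t - fcost s
      else wSw s * (cFF I s t + θ t) - fcost s

  vSwL vTrL vPenL : ℚ
  vSwL  = sumFin (λ s → ifq (isLight s) (vSw s))
  vTrL  = sumFin (λ s → ifq (isLight s) (vTr s))
  vPenL = sumFin (λ s → ifq (isLight s) (vPen s))

  bound : ℚ
  bound = (1ℚ + 1ℚ) * vSwL + vTrL + vPenL - cf I isLight + cf I S*minusS

  objective : (Fin nF → Fin nF → ℚ) → ℚ
  objective y =
    sumFin (λ s → ifq (isLight s)
      (sumFin (λ t → ifq (inT t ∧ not (s ==F t)) (chat s t * y s t))))

  -- feasibility for the LP (y_ss = 0 since ĉ_ss = ∞ and the cost is finite)
  record LPFeasible (y : Fin nF → Fin nF → ℚ) : Set where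
    field
      nonneg   : ∀ s t → isLight s ≡ true → inT t ≡ true → 0ℚ ≤ y s t
      rowSum   : ∀ s → isLight s ≡ true → sumFin (λ t → ifq (inT t) (y s t)) ≡ 1ℚ
      colSum   : ∀ t → S*minusS t ≡ true → sumFin (λ s → ifq (isLight s) (y s t)) ≤ 1ℚ
      diagZero : ∀ s → isLight s ≡ true → y s s ≡ 0ℚ

{-# OPTIONS --safe #-}
module Submission where

-- Write w s t for w(Sw(s,t)).  A light s spreads its unit row over S* \ S in proportion to
-- w s t.  Each t ∈ S* \ S is kept only by its primary light facility, the one with the
-- largest w s t, so a column sum is a single share w s t / w(Sw(s,·)) ≤ 1; every other light
-- s re-routes its share of t to the light facilities v ≠ s in proportion to w v t.
-- Every share of s carries −f_s (in total −c_f(L)), a kept share carries f_t (in total at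
-- most c_f(S* \ S)), and every share pays w s t c_st, which the swap paths from s to t cover:
-- they avoid N and N*, so they are no shorter than c_st.  A re-routed share pays on top the
-- detour c_tv + θ(v), as c_sv ≤ c_st + c_tv.  Since the primary has maximal weight, v
-- receives at most w v t from t in total, so the detours cost at most
-- Σ_v Σ_t w v t (c_vt + θ(v)) ≤ v(Sw(L,·)) + Σ_v w(Sw(v,·)) θ(v).  Finally the flow leaving v
-- is exactly w(Sw(v,·)) + w(Tr(v,·)) + w(Pen(v)) and w(Sw(v,·)) < U/2, which makes
-- w(Sw(v,·)) θ(v) ≤ v(Tr(v,·)) + v(Pen(v)).

open import Defs
open import Algebra.Bundles using (CommutativeRing)
import Algebra.Properties.CommutativeMonoid.Sum as CommutativeMonoidSum
import Algebra.Properties.Semiring.Sum as SemiringSum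
open import Data.Bool using (Bool; true; false; if_then_else_; _∧_; _∨_; not)
open import Data.Bool.Properties using (∧-identityʳ; ∧-zeroʳ; ∧-assoc; ∧-idem)
open import Data.Empty using (⊥-elim)
open import Data.Fin using (Fin; zero; suc)
open import Data.Fin.Properties using () renaming (_≟_ to _≟F_)
open import Data.List using (List; []; _∷_; allFin)
import Data.List.Extrema
open import Data.List.Membership.Propositional.Properties using (∈-allFin)
open import Data.List.Relation.Unary.All as All using (All; []; _∷_)
open import Data.Nat using (ℕ; zero; suc)
open import Data.Product using (Σ; _×_; _,_; proj₁; proj₂)
open import Data.Rational using (ℚ; 0ℚ; 1ℚ; ½; _+_; _*_; _-_; -_; _≤_; _<_; 1/_; ≢-nonZero; positive; nonNegative)
open import Data.Rational.Properties
open import Data.Rational.Solver using (module +-*-Solver)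
open import Data.Sum using (inj₁; inj₂)
open import Function using (_∘_)
open import Relation.Binary.Bundles using (DecTotalOrder)
open import Relation.Binary.Definitions using (tri<; tri≈; tri>)
open import Relation.Binary.PropositionalEquality
open import Relation.Nullary using (yes; no; Dec; contradiction)
open import Relation.Nullary.Decidable using (⌊_⌋)

open +-*-Solver using (solve; _:+_; _:*_; _:-_; :-_; _:=_; con)

private
  variable
    p q r : ℚ

==F-refl : ∀ {n} (i : Fin n) → (i ==F i) ≡ true
==F-refl i with i ≟F i
... | yes _    = refl
... | no i≢i   = ⊥-elim (i≢i refl)

==F⇒≡ : ∀ {n} {i j : Fin n} → (i ==F j) ≡ true → i ≡ j
==F⇒≡ {i = i} {j} i==j with i ≟F j
... | yes i≡j = i≡j

==F-sym : ∀ {n} (i j : Fin n) → (i ==F j) ≡ (j ==F i)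
==F-sym i j with i ≟F j | j ≟F i
... | yes _   | yes _   = refl
... | no _    | no _    = refl
... | yes i≡j | no j≢i  = ⊥-elim (j≢i (sym i≡j))
... | no i≢j  | yes j≡i = ⊥-elim (i≢j (sym j≡i))

==F-suc : ∀ {n} (i j : Fin n) → (suc i ==F suc j) ≡ (i ==F j)
==F-suc i j with i ≟F j
... | yes _ = refl
... | no _  = refl

∧≡true : ∀ {a b} → (a ∧ b) ≡ true → a ≡ true × b ≡ true
∧≡true {true} b≡true = refl , b≡true

not≡true⇒≡false : ∀ {b} → not b ≡ true → b ≡ false
not≡true⇒≡false {false} _ = refl

==N⇒≡ : ∀ {n} {a b : FNode n} → (a ==N b) ≡ true → a ≡ b
==N⇒≡ {a = fac i}  {fac j}  i==j = cong fac (==F⇒≡ i==j)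
==N⇒≡ {a = nodeN}  {nodeN}  _    = refl
==N⇒≡ {a = nodeN*} {nodeN*} _    = refl

0≤1 : 0ℚ ≤ 1ℚ
0≤1 = nonNegative⁻¹ 1ℚ

+-nonNeg : 0ℚ ≤ p → 0ℚ ≤ q → 0ℚ ≤ p + q
+-nonNeg = +-mono-≤

*-nonNeg : 0ℚ ≤ p → 0ℚ ≤ q → 0ℚ ≤ p * q
*-nonNeg {p} {q} 0≤p 0≤q = nonNegative⁻¹ _ {{nonNeg*nonNeg⇒nonNeg p {{nonNegative 0≤p}} q {{nonNegative 0≤q}}}}

*-monoˡ-≤-0≤ : 0ℚ ≤ r → p ≤ q → r * p ≤ r * q
*-monoˡ-≤-0≤ {r} 0≤r = *-monoˡ-≤-nonNeg r {{nonNegative 0≤r}}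

*-monoʳ-≤-0≤ : 0ℚ ≤ r → p ≤ q → p * r ≤ q * r
*-monoʳ-≤-0≤ {r} 0≤r = *-monoʳ-≤-nonNeg r {{nonNegative 0≤r}}

p≤p+q : 0ℚ ≤ q → p ≤ p + q
p≤p+q {q} {p} 0≤q = ≤-trans (≤-reflexive (sym (+-identityʳ p))) (+-monoʳ-≤ p 0≤q)

p≤q⇒0≤q-p : p ≤ q → 0ℚ ≤ q - p
p≤q⇒0≤q-p {p} p≤q = ≤-trans (≤-reflexive (sym (+-inverseʳ p))) (+-monoˡ-≤ (- p) p≤q)

0≤q-p⇒p≤q : 0ℚ ≤ q - p → p ≤ q
0≤q-p⇒p≤q {q} {p} 0≤q-p = begin
  p               ≡⟨ +-identityˡ p ⟨
  0ℚ + p          ≤⟨ +-monoˡ-≤ p 0≤q-p ⟩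
  q - p + p       ≡⟨ solve 2 (λ p q → (q :- p) :+ p := q) refl p q ⟩
  q               ∎
  where open ≤-Reasoning

+-cancelˡ-≤ : ∀ r → r + p ≤ r + q → p ≤ q
+-cancelˡ-≤ {p} {q} r r+p≤r+q = 0≤q-p⇒p≤q (≤-trans (p≤q⇒0≤q-p r+p≤r+q)
  (≤-reflexive (solve 3 (λ r p q → (r :+ q) :- (r :+ p) := q :- p) refl r p q)))

p+q≡0⇒p≡0 : 0ℚ ≤ p → 0ℚ ≤ q → p + q ≡ 0ℚ → p ≡ 0ℚ
p+q≡0⇒p≡0 {p} 0≤p 0≤q p+q≡0 = ≤-antisym (≤-trans (p≤p+q 0≤q) (≤-reflexive p+q≡0)) 0≤p

p+q≡0⇒q≡0 : 0ℚ ≤ p → 0ℚ ≤ q → p + q ≡ 0ℚ → q ≡ 0ℚ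
p+q≡0⇒q≡0 {p} {q} 0≤p 0≤q p+q≡0 = p+q≡0⇒p≡0 0≤q 0≤p (trans (+-comm q p) p+q≡0)

≤∧≢⇒< : p ≤ q → p ≢ q → p < q
≤∧≢⇒< {p} {q} p≤q p≢q with <-cmp p q
... | tri< p<q _ _ = p<q
... | tri≈ _ p≡q _ = ⊥-elim (p≢q p≡q)
... | tri> _ _ q<p = ⊥-elim (<-irrefl refl (<-≤-trans q<p p≤q))

p-q≡0⇒p≡q : p - q ≡ 0ℚ → p ≡ q
p-q≡0⇒p≡q {p} {q} p-q≡0 = begin
  p              ≡⟨ solve 2 (λ p q → p := (p :- q) :+ q) refl p q ⟩
  (p - q) + q    ≡⟨ cong (_+ q) p-q≡0 ⟩
  0ℚ + q         ≡⟨ +-identityˡ q ⟩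
  q              ∎
  where open ≡-Reasoning

0<p⇒p≢0 : 0ℚ < p → p ≢ 0ℚ
0<p⇒p≢0 0<p = ≢-sym (<⇒≢ 0<p)

-p≡p*-1 : ∀ p → - p ≡ p * - 1ℚ
-p≡p*-1 p = solve 1 (λ p → :- p := p :* (:- con 1ℚ)) refl p

-- inv 0ℚ = 0ℚ, as for the total division _/'_.
inv : ℚ → ℚ
inv q = 1ℚ /' q

/'≡*inv : ∀ p q → p /' q ≡ p * inv q
/'≡*inv p q with q ≟ 0ℚ
... | yes _ = sym (*-zeroʳ p)
... | no _  = cong (p *_) (sym (*-identityˡ _))

inv-nonZero : (q≢0 : q ≢ 0ℚ) → inv q ≡ (1/ q) {{≢-nonZero q≢0}}
inv-nonZero {q} q≢0 with q ≟ 0ℚ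
... | yes q≡0 = ⊥-elim (q≢0 q≡0)
... | no _    = *-identityˡ _

*-inv : q ≢ 0ℚ → q * inv q ≡ 1ℚ
*-inv {q} q≢0 = trans (cong (q *_) (inv-nonZero q≢0)) (*-inverseʳ q {{≢-nonZero q≢0}})

inv-nonNeg : 0ℚ ≤ q → 0ℚ ≤ inv q
inv-nonNeg {q} 0≤q = by-cases (q ≟ 0ℚ)
  where
  by-cases : Dec (q ≡ 0ℚ) → 0ℚ ≤ inv q
  by-cases (yes q≡0) = ≤-reflexive (sym (cong inv q≡0))
  by-cases (no q≢0)  = ≤-trans (<⇒≤ (positive⁻¹ _ {{1/pos⇒pos q {{q>0}}}})) (≤-reflexive (sym (inv-nonZero q≢0)))
    where q>0 = positive (≤∧≢⇒< 0≤q (λ 0≡q → q≢0 (sym 0≡q)))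

inv-antimono-≤ : 0ℚ < p → p ≤ q → inv q ≤ inv p
inv-antimono-≤ {p} {q} 0<p p≤q = begin
  inv q                   ≡⟨ *-identityʳ (inv q) ⟨
  inv q * 1ℚ              ≡⟨ cong (inv q *_) (*-inv (0<p⇒p≢0 0<p)) ⟨
  inv q * (p * inv p)     ≤⟨ *-monoˡ-≤-0≤ (inv-nonNeg 0≤q) (*-monoʳ-≤-0≤ (inv-nonNeg (<⇒≤ 0<p)) p≤q) ⟩
  inv q * (q * inv p)     ≡⟨ solve 3 (λ iq q ip → iq :* (q :* ip) := (q :* iq) :* ip) refl (inv q) q (inv p) ⟩
  (q * inv q) * inv p     ≡⟨ cong (_* inv p) (*-inv (0<p⇒p≢0 (<-≤-trans 0<p p≤q))) ⟩
  1ℚ * inv p              ≡⟨ *-identityˡ _ ⟩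
  inv p                   ∎
  where
  open ≤-Reasoning
  0≤q = ≤-trans (<⇒≤ 0<p) p≤q

*-inv-cancel : q ≢ 0ℚ → q * (p * inv q) ≡ p
*-inv-cancel {q} {p} q≢0 = begin
  q * (p * inv q)   ≡⟨ solve 3 (λ q p i → q :* (p :* i) := p :* (q :* i)) refl q p (inv q) ⟩
  p * (q * inv q)   ≡⟨ cong (p *_) (*-inv q≢0) ⟩
  p * 1ℚ            ≡⟨ *-identityʳ p ⟩
  p                 ∎
  where open ≡-Reasoning

p*q≡0⇒q≡0 : 0ℚ < p → p * q ≡ 0ℚ → q ≡ 0ℚ
p*q≡0⇒q≡0 {p} {q} 0<p p*q≡0 = begin
  q                  ≡⟨ *-inv-cancel (0<p⇒p≢0 0<p) ⟨
  p * (q * inv p)    ≡⟨ solve 3 (λ p q i → p :* (q :* i) := (p :* q) :* i) refl p q (inv p) ⟩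
  (p * q) * inv p    ≡⟨ cong (_* inv p) p*q≡0 ⟩
  0ℚ * inv p         ≡⟨ *-zeroˡ (inv p) ⟩
  0ℚ                 ∎
  where open ≡-Reasoning

/'-nonNeg : 0ℚ ≤ p → 0ℚ ≤ q → 0ℚ ≤ p /' q
/'-nonNeg {p} {q} 0≤p 0≤q = ≤-trans (*-nonNeg 0≤p (inv-nonNeg 0≤q)) (≤-reflexive (sym (/'≡*inv p q)))

*-/'≤ : ∀ {a} → 0ℚ ≤ p → 0ℚ ≤ a → a ≤ q → a * (p /' q) ≤ p
*-/'≤ {p} {q} {a} 0≤p 0≤a a≤q = ≤-trans (≤-reflexive (cong (a *_) (/'≡*inv p q))) (by-cases (q ≟ 0ℚ))
  where
  by-cases : Dec (q ≡ 0ℚ) → a * (p * inv q) ≤ p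
  by-cases (yes q≡0) = ≤-trans (≤-reflexive (trans (cong (λ z → a * (p * inv z)) q≡0)
                                              (trans (cong (a *_) (*-zeroʳ p)) (*-zeroʳ a)))) 0≤p
  by-cases (no q≢0)  = ≤-trans (*-monoʳ-≤-0≤ (*-nonNeg 0≤p (inv-nonNeg (≤-trans 0≤a a≤q))) a≤q)
                               (≤-reflexive (*-inv-cancel q≢0))

ratio≤1 : 0ℚ ≤ p → p ≤ q → p * inv q ≤ 1ℚ
ratio≤1 {p} {q} 0≤p p≤q = by-cases (q ≟ 0ℚ)
  where
  by-cases : Dec (q ≡ 0ℚ) → p * inv q ≤ 1ℚ
  by-cases (yes q≡0) = ≤-trans (≤-reflexive (trans (cong (λ z → p * inv z) q≡0) (*-zeroʳ p))) 0≤1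
  by-cases (no q≢0)  = ≤-trans (*-monoʳ-≤-0≤ (inv-nonNeg (≤-trans 0≤p p≤q)) p≤q) (≤-reflexive (*-inv q≢0))

module +-Sum = CommutativeMonoidSum +-0-commutativeMonoid
module *-Sum = SemiringSum (CommutativeRing.semiring +-*-commutativeRing)

sumFin≡sum : ∀ {n} (f : Fin n → ℚ) → sumFin f ≡ +-Sum.sum f
sumFin≡sum {zero}  f = refl
sumFin≡sum {suc n} f = cong (f zero +_) (sumFin≡sum (f ∘ suc))

module _ {n : ℕ} where

  sumFin-cong : {f g : Fin n → ℚ} → (∀ i → f i ≡ g i) → sumFin f ≡ sumFin g
  sumFin-cong {f} {g} f≗g = trans (sumFin≡sum f) (trans (+-Sum.sum-cong-≗ f≗g) (sym (sumFin≡sum g)))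

  sumFin-+ : (f g : Fin n → ℚ) → sumFin (λ i → f i + g i) ≡ sumFin f + sumFin g
  sumFin-+ f g = trans (sumFin≡sum (λ i → f i + g i)) (trans (+-Sum.∑-distrib-+ f g)
                   (sym (cong₂ _+_ (sumFin≡sum f) (sumFin≡sum g))))

  sumFin-*ˡ : ∀ r (f : Fin n → ℚ) → sumFin (λ i → r * f i) ≡ r * sumFin f
  sumFin-*ˡ r f = trans (sumFin≡sum (λ i → r * f i)) (trans (sym (*-Sum.*-distribˡ-sum r f))
                    (sym (cong (r *_) (sumFin≡sum f))))

  sumFin-*ʳ : ∀ r (f : Fin n → ℚ) → sumFin (λ i → f i * r) ≡ sumFin f * r
  sumFin-*ʳ r f = trans (sumFin≡sum (λ i → f i * r)) (trans (sym (*-Sum.*-distribʳ-sum r f))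
                    (sym (cong (_* r) (sumFin≡sum f))))

  sumFin-neg : (f : Fin n → ℚ) → sumFin (λ i → - f i) ≡ - sumFin f
  sumFin-neg f = trans (sumFin-cong (λ i → -p≡p*-1 (f i))) (trans (sumFin-*ʳ (- 1ℚ) f) (sym (-p≡p*-1 (sumFin f))))

  sumFin-- : (f g : Fin n → ℚ) → sumFin (λ i → f i - g i) ≡ sumFin f - sumFin g
  sumFin-- f g = trans (sumFin-+ f (λ i → - g i)) (cong (sumFin f +_) (sumFin-neg g))

  sumFin-zero : {f : Fin n → ℚ} → (∀ i → f i ≡ 0ℚ) → sumFin f ≡ 0ℚ
  sumFin-zero {f} f≡0 = trans (sumFin-cong (λ i → trans (f≡0 i) (sym (*-zeroˡ 0ℚ))))
                              (trans (sumFin-*ˡ 0ℚ (λ _ → 0ℚ)) (*-zeroˡ (sumFin {n} (λ _ → 0ℚ))))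

  sumFin-mono : {f g : Fin n → ℚ} → (∀ i → f i ≤ g i) → sumFin f ≤ sumFin g
  sumFin-mono {f} {g} f≤g = go n f g f≤g
    where
    go : ∀ m (f g : Fin m → ℚ) → (∀ i → f i ≤ g i) → sumFin f ≤ sumFin g
    go zero    f g f≤g = ≤-refl
    go (suc m) f g f≤g = +-mono-≤ (f≤g zero) (go m (f ∘ suc) (g ∘ suc) (f≤g ∘ suc))

  sumFin-nonNeg : {f : Fin n → ℚ} → (∀ i → 0ℚ ≤ f i) → 0ℚ ≤ sumFin f
  sumFin-nonNeg 0≤f = ≤-trans (≤-reflexive (sym (sumFin-zero {λ _ → 0ℚ} (λ _ → refl)))) (sumFin-mono 0≤f)

sumFin-swap : ∀ {m n} (f : Fin m → Fin n → ℚ) →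
              sumFin (λ i → sumFin (f i)) ≡ sumFin (λ j → sumFin (λ i → f i j))
sumFin-swap {m} {n} f = begin
  sumFin (λ i → sumFin (f i))                              ≡⟨ sumFin≡sum (λ i → sumFin (f i)) ⟩
  +-Sum.sum (λ i → sumFin (f i))                       ≡⟨ +-Sum.sum-cong-≗ {m} (λ i → sumFin≡sum (f i)) ⟩
  +-Sum.sum (λ i → +-Sum.sum (f i))                ≡⟨ +-Sum.∑-comm f ⟩
  +-Sum.sum (λ j → +-Sum.sum (λ i → f i j))        ≡⟨ +-Sum.sum-cong-≗ {n} (λ j → sumFin≡sum (λ i → f i j)) ⟨
  +-Sum.sum (λ j → sumFin (λ i → f i j))               ≡⟨ sumFin≡sum (λ j → sumFin (λ i → f i j)) ⟨
  sumFin (λ j → sumFin (λ i → f i j))                      ∎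
  where open ≡-Reasoning

sumFin-pick : ∀ {n} (i : Fin n) (h : Fin n → ℚ) → sumFin (λ v → ifq (i ==F v) (h v)) ≡ h i
sumFin-pick {suc n} zero h = begin
  h zero + sumFin (λ v → ifq (zero ==F suc v) (h (suc v)))   ≡⟨ cong (h zero +_) (sumFin-zero {n} (λ _ → refl)) ⟩
  h zero + 0ℚ                                                 ≡⟨ +-identityʳ _ ⟩
  h zero                                                      ∎
  where open ≡-Reasoning
sumFin-pick {suc n} (suc i) h = begin
  0ℚ + sumFin (λ v → ifq (suc i ==F suc v) (h (suc v)))   ≡⟨ +-identityˡ _ ⟩
  sumFin (λ v → ifq (suc i ==F suc v) (h (suc v)))        ≡⟨ sumFin-cong (λ v → cong (λ b → ifq b (h (suc v))) (==F-suc i v)) ⟩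
  sumFin (λ v → ifq (i ==F v) (h (suc v)))                ≡⟨ sumFin-pick i (h ∘ suc) ⟩
  h (suc i)                                               ∎
  where open ≡-Reasoning

sumFin-pickʳ : ∀ {n} (i : Fin n) (h : Fin n → ℚ) → sumFin (λ v → ifq (v ==F i) (h v)) ≡ h i
sumFin-pickʳ i h = trans (sumFin-cong (λ v → cong (λ b → ifq b (h v)) (==F-sym v i))) (sumFin-pick i h)

ifq-0 : ∀ b → ifq b 0ℚ ≡ 0ℚ
ifq-0 true  = refl
ifq-0 false = refl

ifq-+ : ∀ b p q → ifq b (p + q) ≡ ifq b p + ifq b q
ifq-+ true  p q = refl
ifq-+ false p q = sym (+-identityˡ 0ℚ)

ifq-- : ∀ b p q → ifq b (p - q) ≡ ifq b p - ifq b q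
ifq-- true  p q = refl
ifq-- false p q = refl

ifq-*ˡ : ∀ b r p → ifq b (r * p) ≡ r * ifq b p
ifq-*ˡ true  r p = refl
ifq-*ˡ false r p = sym (*-zeroʳ r)

ifq-*ʳ : ∀ b r p → ifq b (p * r) ≡ ifq b p * r
ifq-*ʳ true  r p = refl
ifq-*ʳ false r p = sym (*-zeroˡ r)

ifq-∧ : ∀ a b p → ifq (a ∧ b) p ≡ ifq a (ifq b p)
ifq-∧ true  b p = refl
ifq-∧ false b p = refl

ifq-comm : ∀ a b p → ifq a (ifq b p) ≡ ifq b (ifq a p)
ifq-comm true  b     p = refl
ifq-comm false true  p = refl
ifq-comm false false p = refl

ifq-split : ∀ b p → p ≡ ifq b p + ifq (not b) p
ifq-split true  p = sym (+-identityʳ p)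
ifq-split false p = sym (+-identityˡ p)

ifq-nonNeg : ∀ b → 0ℚ ≤ p → 0ℚ ≤ ifq b p
ifq-nonNeg true  0≤p = 0≤p
ifq-nonNeg false 0≤p = ≤-refl

ifq≤ : ∀ b → 0ℚ ≤ p → ifq b p ≤ p
ifq≤ true  0≤p = ≤-refl
ifq≤ false 0≤p = 0≤p

ifq-congᵗ : ∀ b → (b ≡ true → p ≡ q) → ifq b p ≡ ifq b q
ifq-congᵗ true  p≡q = p≡q refl
ifq-congᵗ false p≡q = refl

ifq-monoᵗ : ∀ b → (b ≡ true → p ≤ q) → ifq b p ≤ ifq b q
ifq-monoᵗ true  p≤q = p≤q refl
ifq-monoᵗ false p≤q = ≤-refl

ifq-nonNegᵗ : ∀ b → (b ≡ true → 0ℚ ≤ p) → 0ℚ ≤ ifq b p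
ifq-nonNegᵗ true  0≤p = 0≤p refl
ifq-nonNegᵗ false 0≤p = ≤-refl

ifq-sumFin : ∀ {n} b (f : Fin n → ℚ) → ifq b (sumFin f) ≡ sumFin (λ i → ifq b (f i))
ifq-sumFin true  f = refl
ifq-sumFin {n} false f = sym (sumFin-zero {n} (λ i → refl))

data ExactlyOne : Bool → Bool → Bool → Set where
  first  : ExactlyOne true false false
  second : ExactlyOne false true false
  third  : ExactlyOne false false true

ifq-partition : ∀ a p {e₁ e₂ e₃} → ExactlyOne e₁ e₂ e₃ →
                ifq a p ≡ ifq (a ∧ e₁) p + ifq (a ∧ e₂) p + ifq (a ∧ e₃) p
ifq-partition false p _      = refl
ifq-partition true  p first  = sym (trans (+-identityʳ (p + 0ℚ)) (+-identityʳ p))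
ifq-partition true  p second = sym (trans (+-identityʳ (0ℚ + p)) (+-identityˡ p))
ifq-partition true  p third  = sym (trans (cong (_+ p) (+-identityˡ 0ℚ)) (+-identityˡ p))

sumOver : ∀ {n} → (Fin n → Bool) → (Fin n → ℚ) → ℚ
sumOver A h = sumFin (λ i → ifq (A i) (h i))

sumFin-split : ∀ {n} (i : Fin n) (h : Fin n → ℚ) →
               sumFin h ≡ h i + sumFin (λ v → ifq (not (i ==F v)) (h v))
sumFin-split i h = begin
  sumFin h
    ≡⟨ sumFin-cong (λ v → ifq-split (i ==F v) (h v)) ⟩
  sumFin (λ v → ifq (i ==F v) (h v) + ifq (not (i ==F v)) (h v))
    ≡⟨ sumFin-+ (λ v → ifq (i ==F v) (h v)) (λ v → ifq (not (i ==F v)) (h v)) ⟩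
  sumFin (λ v → ifq (i ==F v) (h v)) + sumFin (λ v → ifq (not (i ==F v)) (h v))
    ≡⟨ cong (_+ sumFin (λ v → ifq (not (i ==F v)) (h v))) (sumFin-pick i h) ⟩
  h i + sumFin (λ v → ifq (not (i ==F v)) (h v))
    ∎
  where open ≡-Reasoning

single≤sumFin : ∀ {n} (i : Fin n) {h : Fin n → ℚ} → (∀ v → 0ℚ ≤ h v) → h i ≤ sumFin h
single≤sumFin i {h} 0≤h = ≤-trans (p≤p+q (sumFin-nonNeg (λ v → ifq-nonNeg (not (i ==F v)) (0≤h v))))
                                  (≤-reflexive (sym (sumFin-split i h)))

sumFin-ratio≤1 : ∀ {n} (a d : Fin n → ℚ) → (∀ i → 0ℚ ≤ a i) → (∀ i → sumFin a ≤ d i) →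
                 sumFin (λ i → a i * inv (d i)) ≤ 1ℚ
sumFin-ratio≤1 a d 0≤a Σa≤d = begin
  sumFin (λ i → a i * inv (d i))   ≤⟨ sumFin-mono (λ i → termwise i (a i ≟ 0ℚ)) ⟩
  sumFin (λ i → a i * inv (sumFin a))   ≡⟨ sumFin-*ʳ (inv (sumFin a)) a ⟩
  sumFin a * inv (sumFin a)             ≤⟨ ratio≤1 (sumFin-nonNeg 0≤a) ≤-refl ⟩
  1ℚ                                    ∎
  where
  open ≤-Reasoning
  termwise : ∀ i → Dec (a i ≡ 0ℚ) → a i * inv (d i) ≤ a i * inv (sumFin a)
  termwise i (yes aᵢ≡0) = ≤-reflexive (trans (vanishes (inv (d i))) (sym (vanishes (inv (sumFin a)))))
    where
    vanishes : ∀ r → a i * r ≡ 0ℚ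
    vanishes r = trans (cong (_* r) aᵢ≡0) (*-zeroˡ r)
  termwise i (no aᵢ≢0)  = *-monoˡ-≤-0≤ (0≤a i) (inv-antimono-≤ 0<Σa (Σa≤d i))
    where 0<Σa = <-≤-trans (≤∧≢⇒< (0≤a i) (λ 0≡aᵢ → aᵢ≢0 (sym 0≡aᵢ))) (single≤sumFin i 0≤a)

module _ {n : ℕ} (A : Fin n → Bool) where

  sumOver-cong : {f g : Fin n → ℚ} → (∀ i → A i ≡ true → f i ≡ g i) → sumOver A f ≡ sumOver A g
  sumOver-cong f≡g = sumFin-cong (λ i → ifq-congᵗ (A i) (f≡g i))

  sumOver-mono : {f g : Fin n → ℚ} → (∀ i → A i ≡ true → f i ≤ g i) → sumOver A f ≤ sumOver A g
  sumOver-mono f≤g = sumFin-mono (λ i → ifq-monoᵗ (A i) (f≤g i))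

  sumOver-nonNeg : {f : Fin n → ℚ} → (∀ i → A i ≡ true → 0ℚ ≤ f i) → 0ℚ ≤ sumOver A f
  sumOver-nonNeg 0≤f = sumFin-nonNeg (λ i → ifq-nonNegᵗ (A i) (0≤f i))

  sumOver-+ : (f g : Fin n → ℚ) → sumOver A (λ i → f i + g i) ≡ sumOver A f + sumOver A g
  sumOver-+ f g = trans (sumFin-cong (λ i → ifq-+ (A i) (f i) (g i)))
                        (sumFin-+ (λ i → ifq (A i) (f i)) (λ i → ifq (A i) (g i)))

  sumOver-*ˡ : ∀ r (f : Fin n → ℚ) → sumOver A (λ i → r * f i) ≡ r * sumOver A f
  sumOver-*ˡ r f = trans (sumFin-cong (λ i → ifq-*ˡ (A i) r (f i))) (sumFin-*ˡ r (λ i → ifq (A i) (f i)))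

  sumOver-*ʳ : ∀ r (f : Fin n → ℚ) → sumOver A (λ i → f i * r) ≡ sumOver A f * r
  sumOver-*ʳ r f = trans (sumFin-cong (λ i → ifq-*ʳ (A i) r (f i))) (sumFin-*ʳ r (λ i → ifq (A i) (f i)))

  sumOver-- : (f g : Fin n → ℚ) → sumOver A (λ i → f i - g i) ≡ sumOver A f - sumOver A g
  sumOver-- f g = trans (sumFin-cong (λ i → ifq-- (A i) (f i) (g i)))
                        (sumFin-- (λ i → ifq (A i) (f i)) (λ i → ifq (A i) (g i)))

  sumOver-f+g+h-k : (f g h k : Fin n → ℚ) →
                    sumOver A (λ i → f i + g i + h i - k i) ≡ sumOver A f + sumOver A g + sumOver A h - sumOver A k
  sumOver-f+g+h-k f g h k = trans (sumOver-- (λ i → f i + g i + h i) k)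
    (cong (_- sumOver A k) (trans (sumOver-+ (λ i → f i + g i) h) (cong (_+ sumOver A h) (sumOver-+ f g))))

module _ {A : Set} where

  sumList-cong : ∀ {f g : A → ℚ} xs → (∀ a → f a ≡ g a) → sumList f xs ≡ sumList g xs
  sumList-cong []       f≡g = refl
  sumList-cong (a ∷ xs) f≡g = cong₂ _+_ (f≡g a) (sumList-cong xs f≡g)

  sumList-congᴬ : ∀ {f g : A → ℚ} {xs} → All (λ a → f a ≡ g a) xs → sumList f xs ≡ sumList g xs
  sumList-congᴬ []         = refl
  sumList-congᴬ (fa≡ga ∷ h) = cong₂ _+_ fa≡ga (sumList-congᴬ h)

  sumList-monoᴬ : ∀ {f g : A → ℚ} {xs} → All (λ a → f a ≤ g a) xs → sumList f xs ≤ sumList g xs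
  sumList-monoᴬ []          = ≤-refl
  sumList-monoᴬ (fa≤ga ∷ h) = +-mono-≤ fa≤ga (sumList-monoᴬ h)

  sumList-nonNegᴬ : ∀ {f : A → ℚ} {xs} → All (λ a → 0ℚ ≤ f a) xs → 0ℚ ≤ sumList f xs
  sumList-nonNegᴬ []         = ≤-refl
  sumList-nonNegᴬ (0≤fa ∷ h) = +-nonNeg 0≤fa (sumList-nonNegᴬ h)

  sumList≡0⇒All≡0 : ∀ {f : A → ℚ} {xs} → All (λ a → 0ℚ ≤ f a) xs → sumList f xs ≡ 0ℚ → All (λ a → f a ≡ 0ℚ) xs
  sumList≡0⇒All≡0 []         _   = []
  sumList≡0⇒All≡0 (0≤fa ∷ h) Σ≡0 =
    p+q≡0⇒p≡0 0≤fa (sumList-nonNegᴬ h) Σ≡0 ∷ sumList≡0⇒All≡0 h (p+q≡0⇒q≡0 0≤fa (sumList-nonNegᴬ h) Σ≡0)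

  sumList-+ : ∀ (f g : A → ℚ) xs → sumList (λ a → f a + g a) xs ≡ sumList f xs + sumList g xs
  sumList-+ f g []       = sym (+-identityˡ 0ℚ)
  sumList-+ f g (a ∷ xs) = trans (cong (f a + g a +_) (sumList-+ f g xs))
    (solve 4 (λ a b c d → (a :+ b) :+ (c :+ d) := (a :+ c) :+ (b :+ d)) refl (f a) (g a) (sumList f xs) (sumList g xs))

  sumList-*ʳ : ∀ r (f : A → ℚ) xs → sumList (λ a → f a * r) xs ≡ sumList f xs * r
  sumList-*ʳ r f []       = sym (*-zeroˡ r)
  sumList-*ʳ r f (a ∷ xs) = trans (cong (f a * r +_) (sumList-*ʳ r f xs)) (sym (*-distribʳ-+ r (f a) (sumList f xs)))

  sumList-sumFin : ∀ {n} (f : A → Fin n → ℚ) xs →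
                   sumList (λ a → sumFin (f a)) xs ≡ sumFin (λ i → sumList (λ a → f a i) xs)
  sumList-sumFin {n} f []       = sym (sumFin-zero {n} (λ _ → refl))
  sumList-sumFin     f (a ∷ xs) = trans (cong (sumFin (f a) +_) (sumList-sumFin f xs))
                                        (sym (sumFin-+ (f a) (λ i → sumList (λ b → f b i) xs)))

  ifq-sumList : ∀ b (f : A → ℚ) xs → ifq b (sumList f xs) ≡ sumList (λ a → ifq b (f a)) xs
  ifq-sumList true  f xs       = refl
  ifq-sumList false f []       = refl
  ifq-sumList false f (a ∷ xs) = trans (sym (+-identityˡ 0ℚ)) (cong (0ℚ +_) (ifq-sumList false f xs))

∀-All⇒All-∀ : ∀ {A B : Set} {Q : B → A → Set} {xs : List A} → (∀ b → All (Q b) xs) → All (λ a → ∀ b → Q b a) xs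
∀-All⇒All-∀ {xs = []}     h = []
∀-All⇒All-∀ {xs = a ∷ xs} h = (λ b → All.head (h b)) ∷ ∀-All⇒All-∀ (λ b → All.tail (h b))

sumList-- : ∀ {A : Set} (f g : A → ℚ) xs → sumList (λ a → f a - g a) xs ≡ sumList f xs - sumList g xs
sumList-- f g xs = trans (sumList-+ f (λ a → - g a) xs) (cong (sumList f xs +_) (begin
  sumList (λ a → - g a) xs        ≡⟨ sumList-cong xs (λ a → -p≡p*-1 (g a)) ⟩
  sumList (λ a → g a * - 1ℚ) xs   ≡⟨ sumList-*ʳ (- 1ℚ) g xs ⟩
  sumList g xs * - 1ℚ             ≡⟨ -p≡p*-1 (sumList g xs) ⟨
  - sumList g xs                  ∎))
  where open ≡-Reasoning

-- The fractional reassignment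

-- The construction of the header for abstract data: L the light facilities, T = S* \ S,
-- w s t = w(Sw(s,t)), ws s = w(Sw(s,·)), c and f the distances and opening costs; chat and
-- objective are those of Setup.
module Reassignment {n : ℕ}
  (L T : Fin n → Bool)
  (w c : Fin n → Fin n → ℚ)
  (ws θ f vS vR : Fin n → ℚ)
  (L⇒¬T : ∀ s → L s ≡ true → T s ≡ false)
  (w-nonNeg : ∀ s t → 0ℚ ≤ w s t)
  (ws-pos : ∀ s → L s ≡ true → 0ℚ < ws s)
  (ws-row : ∀ s → L s ≡ true → sumOver T (w s) ≡ ws s)
  (c-nonNeg : ∀ s t → 0ℚ ≤ c s t)
  (c-sym : ∀ s t → c s t ≡ c t s)
  (c-tri : ∀ s t u → c s u ≤ c s t + c t u)
  (f-nonNeg : ∀ i → 0ℚ ≤ f i)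
  (θ-nonNeg : ∀ u → L u ≡ true → 0ℚ ≤ θ u)
  (vS-charge : ∀ s → L s ≡ true → sumOver T (λ t → w s t * c s t) ≤ vS s)
  (vR-charge : ∀ u → L u ≡ true → ws u * θ u ≤ vR u)
  where

  open Data.List.Extrema (DecTotalOrder.totalOrder ≤-decTotalOrder) using (argmax; f[xs]≤f[argmax])

  chatT chatL chat : Fin n → Fin n → ℚ
  chatT s t = ws s * c s t + f t - f s
  chatL s v = ws s * (c s v + θ v) - f s
  chat s t = if T t then chatT s t else chatL s t

  objective : (Fin n → Fin n → ℚ) → ℚ
  objective y = sumOver L (λ s → sumFin (λ t → ifq ((T t ∨ L t) ∧ not (s ==F t)) (chat s t * y s t)))

  otherLight : Fin n → Fin n → Bool
  otherLight s v = L v ∧ not (s ==F v)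

  lw : Fin n → Fin n → ℚ
  lw t v = ifq (L v) (w v t)

  primary : Fin n → Fin n
  primary t = argmax (lw t) t (allFin n)

  share : Fin n → Fin n → ℚ
  share s t = w s t * inv (ws s)

  lwExcept : Fin n → Fin n → ℚ
  lwExcept s t = sumOver (otherLight s) (λ v → w v t)

  spread : Fin n → Fin n → Fin n → ℚ
  spread s t v = w v t * inv (lwExcept s t)

  yT yL y : Fin n → Fin n → ℚ
  yT s t = ifq (s ==F primary t) (share s t)
  yL s v = sumOver T (λ t → ifq (not (s ==F primary t)) (share s t * spread s t v))
  y s v = if T v then yT s v else ifq (not (s ==F v)) (yL s v)

  lw≤lw-primary : ∀ t v → lw t v ≤ lw t (primary t)
  lw≤lw-primary t v = All.lookup (f[xs]≤f[argmax] t (allFin n)) (∈-allFin v)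

  share-nonNeg : ∀ s t → L s ≡ true → 0ℚ ≤ share s t
  share-nonNeg s t ls = *-nonNeg (w-nonNeg s t) (inv-nonNeg (<⇒≤ (ws-pos s ls)))

  lwExcept-nonNeg : ∀ s t → 0ℚ ≤ lwExcept s t
  lwExcept-nonNeg s t = sumOver-nonNeg (otherLight s) (λ v _ → w-nonNeg v t)

  spread-nonNeg : ∀ s t v → 0ℚ ≤ spread s t v
  spread-nonNeg s t v = *-nonNeg (w-nonNeg v t) (inv-nonNeg (lwExcept-nonNeg s t))

  ws*share : ∀ s t → L s ≡ true → ws s * share s t ≡ w s t
  ws*share s t ls = *-inv-cancel (0<p⇒p≢0 (ws-pos s ls))

  sumOver-share : ∀ s → L s ≡ true → sumOver T (share s) ≡ 1ℚ
  sumOver-share s ls = begin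
    sumOver T (share s)             ≡⟨ sumOver-*ʳ T (inv (ws s)) (w s) ⟩
    sumOver T (w s) * inv (ws s)    ≡⟨ cong (_* inv (ws s)) (ws-row s ls) ⟩
    ws s * inv (ws s)               ≡⟨ *-inv (0<p⇒p≢0 (ws-pos s ls)) ⟩
    1ℚ                              ∎
    where open ≡-Reasoning

  share≤1 : ∀ s t → L s ≡ true → T t ≡ true → share s t ≤ 1ℚ
  share≤1 s t ls tt = ratio≤1 (w-nonNeg s t) (begin
    w s t                  ≡⟨ cong (λ b → ifq b (w s t)) tt ⟨
    ifq (T t) (w s t)      ≤⟨ single≤sumFin t (λ u → ifq-nonNeg (T u) (w-nonNeg s u)) ⟩
    sumOver T (w s)        ≡⟨ ws-row s ls ⟩
    ws s                   ∎)
    where open ≤-Reasoning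

  -- If lwExcept s t = 0 then the primary, hence also s, has weight 0 towards t.
  share*sumOver-spread : ∀ s t → L s ≡ true → (s ==F primary t) ≡ false →
                         share s t * sumOver (otherLight s) (spread s t) ≡ share s t
  share*sumOver-spread s t ls s≢primary = trans (cong (share s t *_) (sumOver-*ʳ (otherLight s) _ (λ v → w v t)))
                                                 (by-cases (lwExcept s t ≟ 0ℚ))
    where
    w≤lwExcept : w s t ≤ lwExcept s t
    w≤lwExcept = begin
      w s t                                   ≡⟨ cong (λ b → ifq b (w s t)) ls ⟨
      lw t s                                  ≤⟨ lw≤lw-primary t s ⟩
      ifq (L m) (w m t)                       ≡⟨ cong (λ b → ifq b (w m t)) (sym (∧-identityʳ (L m))) ⟩
      ifq (L m ∧ true) (w m t)                ≡⟨ cong (λ b → ifq (L m ∧ not b) (w m t)) s≢primary ⟨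
      ifq (otherLight s m) (w m t)            ≤⟨ single≤sumFin m (λ u → ifq-nonNeg (otherLight s u) (w-nonNeg u t)) ⟩
      lwExcept s t                            ∎
      where
      open ≤-Reasoning
      m = primary t
    by-cases : Dec (lwExcept s t ≡ 0ℚ) → share s t * (lwExcept s t * inv (lwExcept s t)) ≡ share s t
    by-cases (yes D≡0) = trans (cong (_* ratio) share≡0) (trans (*-zeroˡ ratio) (sym share≡0))
      where
      ratio = lwExcept s t * inv (lwExcept s t)
      share≡0 : share s t ≡ 0ℚ
      share≡0 = trans (cong (_* inv (ws s)) (≤-antisym (≤-trans w≤lwExcept (≤-reflexive D≡0)) (w-nonNeg s t)))
                      (*-zeroˡ (inv (ws s)))
    by-cases (no D≢0)  = trans (cong (share s t *_) (*-inv D≢0)) (*-identityʳ (share s t))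

  sumOver-yL : ∀ s (h : Fin n → ℚ) →
    sumOver (otherLight s) (λ v → h v * yL s v) ≡
    sumOver T (λ t → ifq (not (s ==F primary t)) (share s t * sumOver (otherLight s) (λ v → h v * spread s t v)))
  sumOver-yL s h = begin
    sumOver (otherLight s) (λ v → h v * yL s v)
      ≡⟨ sumFin-cong (λ v → trans (cong (ifq (otherLight s v)) (sym (sumFin-*ˡ (h v) (term v))))
                                  (ifq-sumFin (otherLight s v) (λ t → h v * term v t))) ⟩
    sumFin (λ v → sumFin (λ t → ifq (otherLight s v) (h v * term v t)))
      ≡⟨ sumFin-swap (λ v t → ifq (otherLight s v) (h v * term v t)) ⟩
    sumFin (λ t → sumFin (λ v → ifq (otherLight s v) (h v * term v t)))
      ≡⟨ sumFin-cong (λ t → sumFin-cong (λ v →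
           interchange (otherLight s v) (T t) (not (s ==F primary t)) (h v) (share s t) (spread s t v))) ⟩
    sumFin (λ t → sumFin (λ v → ifq (T t) (ifq (not (s ==F primary t))
                                  (share s t * ifq (otherLight s v) (h v * spread s t v)))))
      ≡⟨ sumFin-cong pull-out ⟩
    sumOver T (λ t → ifq (not (s ==F primary t)) (share s t * sumOver (otherLight s) (λ v → h v * spread s t v))) ∎
    where
    open ≡-Reasoning
    term : Fin n → Fin n → ℚ
    term v t = ifq (T t) (ifq (not (s ==F primary t)) (share s t * spread s t v))
    interchange : ∀ a b d x y z → ifq a (x * ifq b (ifq d (y * z))) ≡ ifq b (ifq d (y * ifq a (x * z)))
    interchange false false d     x y z = refl
    interchange false true  false x y z = refl
    interchange false true  true  x y z = sym (*-zeroʳ y)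
    interchange true  false d     x y z = *-zeroʳ x
    interchange true  true  false x y z = *-zeroʳ x
    interchange true  true  true  x y z = solve 3 (λ x y z → x :* (y :* z) := y :* (x :* z)) refl x y z
    pull-out : ∀ t → sumFin (λ v → ifq (T t) (ifq (not (s ==F primary t)) (share s t * ifq (otherLight s v) (h v * spread s t v))))
                   ≡ ifq (T t) (ifq (not (s ==F primary t)) (share s t * sumOver (otherLight s) (λ v → h v * spread s t v)))
    pull-out t = sym (trans (cong (ifq (T t)) (trans (cong (ifq nm) (sym (sumFin-*ˡ (share s t) inner)))
                                                     (ifq-sumFin nm (λ v → share s t * inner v))))
                            (ifq-sumFin (T t) (λ v → ifq nm (share s t * inner v))))
      where
      nm = not (s ==F primary t)
      inner = λ v → ifq (otherLight s v) (h v * spread s t v)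

  y-nonNeg : ∀ s v → L s ≡ true → 0ℚ ≤ y s v
  y-nonNeg s v ls = if-nonNeg (T v) (ifq-nonNeg (s ==F primary v) (share-nonNeg s v ls))
                                    (ifq-nonNeg (not (s ==F v)) yL-nonNeg)
    where
    if-nonNeg : ∀ b {p q} → 0ℚ ≤ p → 0ℚ ≤ q → 0ℚ ≤ (if b then p else q)
    if-nonNeg true  0≤p 0≤q = 0≤p
    if-nonNeg false 0≤p 0≤q = 0≤q
    yL-nonNeg : 0ℚ ≤ yL s v
    yL-nonNeg = sumOver-nonNeg T (λ t _ → ifq-nonNeg (not (s ==F primary t))
                  (*-nonNeg (share-nonNeg s t ls) (spread-nonNeg s t v)))

  y-diag : ∀ s → L s ≡ true → y s s ≡ 0ℚ
  y-diag s ls = trans (cong (λ b → if b then yT s s else ifq (not (s ==F s)) (yL s s)) (L⇒¬T s ls))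
                      (cong (λ b → ifq (not b) (yL s s)) (==F-refl s))

  y-colSum : ∀ t → T t ≡ true → sumOver L (λ s → y s t) ≤ 1ℚ
  y-colSum t tt = begin
    sumOver L (λ s → y s t)
      ≡⟨ sumOver-cong L (λ s _ → cong (λ b → if b then yT s t else ifq (not (s ==F t)) (yL s t)) tt) ⟩
    sumOver L (λ s → yT s t)
      ≡⟨ sumFin-cong (λ s → ifq-comm (L s) (s ==F primary t) (share s t)) ⟩
    sumFin (λ s → ifq (s ==F primary t) (ifq (L s) (share s t)))
      ≡⟨ sumFin-pickʳ (primary t) (λ s → ifq (L s) (share s t)) ⟩
    ifq (L (primary t)) (share (primary t) t)
      ≤⟨ ifq-monoᵗ (L (primary t)) (λ lm → share≤1 (primary t) t lm tt) ⟩
    ifq (L (primary t)) 1ℚ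
      ≤⟨ ifq≤ (L (primary t)) 0≤1 ⟩
    1ℚ ∎
    where open ≤-Reasoning

  sumOver-yL≡ : ∀ s → L s ≡ true → sumOver (otherLight s) (yL s) ≡ sumOver T (λ t → ifq (not (s ==F primary t)) (share s t))
  sumOver-yL≡ s ls = begin
    sumOver (otherLight s) (yL s)
      ≡⟨ sumOver-cong (otherLight s) (λ v _ → sym (*-identityˡ (yL s v))) ⟩
    sumOver (otherLight s) (λ v → 1ℚ * yL s v)
      ≡⟨ sumOver-yL s (λ _ → 1ℚ) ⟩
    sumOver T (λ t → ifq (not (s ==F primary t)) (share s t * sumOver (otherLight s) (λ v → 1ℚ * spread s t v)))
      ≡⟨ sumOver-cong T (λ t _ → ifq-congᵗ (not (s ==F primary t)) (λ s≢primary → trans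
           (cong (share s t *_) (sumOver-cong (otherLight s) (λ v _ → *-identityˡ (spread s t v))))
           (share*sumOver-spread s t ls (not≡true⇒≡false s≢primary)))) ⟩
    sumOver T (λ t → ifq (not (s ==F primary t)) (share s t)) ∎
    where open ≡-Reasoning

  y-rowSum : ∀ s → L s ≡ true → sumOver (λ v → T v ∨ L v) (y s) ≡ 1ℚ
  y-rowSum s ls = begin
    sumOver (λ v → T v ∨ L v) (y s)
      ≡⟨ sumFin-cong (λ v → split (T v) (L v) (s ==F v) (yT s v) (yL s v) (L⇒¬T v)) ⟩
    sumFin (λ v → ifq (T v) (yT s v) + ifq (otherLight s v) (yL s v))
      ≡⟨ sumFin-+ (λ v → ifq (T v) (yT s v)) (λ v → ifq (otherLight s v) (yL s v)) ⟩
    sumOver T (yT s) + sumOver (otherLight s) (yL s)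
      ≡⟨ cong (sumOver T (yT s) +_) (sumOver-yL≡ s ls) ⟩
    sumOver T (yT s) + sumOver T (λ t → ifq (not (s ==F primary t)) (share s t))
      ≡⟨ sumOver-+ T (yT s) (λ t → ifq (not (s ==F primary t)) (share s t)) ⟨
    sumOver T (λ t → yT s t + ifq (not (s ==F primary t)) (share s t))
      ≡⟨ sumOver-cong T (λ t _ → sym (ifq-split (s ==F primary t) (share s t))) ⟩
    sumOver T (share s)
      ≡⟨ sumOver-share s ls ⟩
    1ℚ ∎
    where
    open ≡-Reasoning
    split : ∀ tv lv sv p q → (lv ≡ true → tv ≡ false) →
            ifq (tv ∨ lv) (if tv then p else ifq (not sv) q) ≡ ifq tv p + ifq (lv ∧ not sv) q
    split true  false sv    p q _   = sym (+-identityʳ p)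
    split true  true  sv    p q l⇒¬t = contradiction (l⇒¬t refl) λ ()
    split false true  true  p q _   = sym (+-identityˡ 0ℚ)
    split false true  false p q _   = sym (+-identityˡ q)
    split false false sv    p q _   = sym (+-identityˡ 0ℚ)

  L∧T⇒≢ : ∀ s v → L s ≡ true → T v ≡ true → (s ==F v) ≡ false
  L∧T⇒≢ s v ls tv with s ==F v in s==v
  ... | false = refl
  ... | true  = contradiction (trans (sym tv) (trans (cong T (sym (==F⇒≡ s==v))) (L⇒¬T s ls))) λ ()

  objective-term : ∀ s v → L s ≡ true →
    ifq ((T v ∨ L v) ∧ not (s ==F v)) (chat s v * y s v) ≡
    ifq (T v) (chatT s v * yT s v) + ifq (otherLight s v) (chatL s v * yL s v)
  objective-term s v ls = split (T v) (L v) (s ==F v) (chatT s v) (chatL s v) (yT s v) (yL s v)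
                                (L⇒¬T v) (L∧T⇒≢ s v ls)
    where
    split : ∀ tv lv sv a b p q → (lv ≡ true → tv ≡ false) → (tv ≡ true → sv ≡ false) →
            ifq ((tv ∨ lv) ∧ not sv) ((if tv then a else b) * (if tv then p else ifq (not sv) q))
              ≡ ifq tv (a * p) + ifq (lv ∧ not sv) (b * q)
    split true  false false a b p q _    _    = sym (+-identityʳ (a * p))
    split true  true  sv    a b p q l⇒¬t _    = contradiction (l⇒¬t refl) λ ()
    split true  false true  a b p q _    t⇒¬s = contradiction (t⇒¬s refl) λ ()
    split false true  true  a b p q _    _    = sym (+-identityˡ 0ℚ)
    split false true  false a b p q _    _    = sym (+-identityˡ (b * q))
    split false false sv    a b p q _    _    = sym (+-identityˡ 0ℚ)

  rerouteCost : Fin n → Fin n → ℚ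
  rerouteCost s t = sumOver (otherLight s) (λ v → (c t v + θ v) * (w s t * spread s t v))

  sumOver-direct-cost : ∀ s t → L s ≡ true → (s ==F primary t) ≡ false →
    sumOver (otherLight s) (λ v → (ws s * c s t - f s) * (share s t * spread s t v)) ≡ w s t * c s t - f s * share s t
  sumOver-direct-cost s t ls s≢primary = begin
    sumOver oL (λ v → K * (share s t * spread s t v))   ≡⟨ sumOver-*ˡ oL K (λ v → share s t * spread s t v) ⟩
    K * sumOver oL (λ v → share s t * spread s t v)     ≡⟨ cong (K *_) (sumOver-*ˡ oL (share s t) (spread s t)) ⟩
    K * (share s t * sumOver oL (spread s t))           ≡⟨ cong (K *_) (share*sumOver-spread s t ls s≢primary) ⟩
    K * share s t                                       ≡⟨ solve 4 (λ W C F S → (W :* C :- F) :* S := (W :* S) :* C :- F :* S)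
                                                                 refl (ws s) (c s t) (f s) (share s t) ⟩
    (ws s * share s t) * c s t - f s * share s t        ≡⟨ cong (λ z → z * c s t - f s * share s t) (ws*share s t ls) ⟩
    w s t * c s t - f s * share s t                     ∎
    where
    open ≡-Reasoning
    oL = otherLight s
    K = ws s * c s t - f s

  rerouted-cost≤ : ∀ s t → L s ≡ true → (s ==F primary t) ≡ false →
    share s t * sumOver (otherLight s) (λ v → chatL s v * spread s t v) ≤
    w s t * c s t - f s * share s t + rerouteCost s t
  rerouted-cost≤ s t ls s≢primary = begin
    share s t * sumOver oL (λ v → chatL s v * spread s t v)
      ≡⟨ sumOver-*ˡ oL (share s t) (λ v → chatL s v * spread s t v) ⟨
    sumOver oL (λ v → share s t * (chatL s v * spread s t v))
      ≤⟨ sumOver-mono oL (λ v _ → via-t v) ⟩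
    sumOver oL (λ v → K * (share s t * spread s t v) + (c t v + θ v) * (w s t * spread s t v))
      ≡⟨ sumOver-+ oL (λ v → K * (share s t * spread s t v)) (λ v → (c t v + θ v) * (w s t * spread s t v)) ⟩
    sumOver oL (λ v → K * (share s t * spread s t v)) + rerouteCost s t
      ≡⟨ cong (_+ rerouteCost s t) (sumOver-direct-cost s t ls s≢primary) ⟩
    w s t * c s t - f s * share s t + rerouteCost s t ∎
    where
    open ≤-Reasoning
    oL = otherLight s
    K = ws s * c s t - f s
    via-t : ∀ v → share s t * (chatL s v * spread s t v) ≤
                  K * (share s t * spread s t v) + (c t v + θ v) * (w s t * spread s t v)
    via-t v = begin
      share s t * ((ws s * (c s v + θ v) - f s) * spread s t v)
        ≤⟨ *-monoˡ-≤-0≤ (share-nonNeg s t ls) (*-monoʳ-≤-0≤ (spread-nonNeg s t v) (+-monoˡ-≤ (- f s)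
             (*-monoˡ-≤-0≤ (<⇒≤ (ws-pos s ls)) (+-monoˡ-≤ (θ v) (c-tri s t v))))) ⟩
      share s t * ((ws s * (c s t + c t v + θ v) - f s) * spread s t v)
        ≡⟨ solve 7 (λ S W C₁ C₂ Θ F E → S :* ((W :* (C₁ :+ C₂ :+ Θ) :- F) :* E)
                      := (W :* C₁ :- F) :* (S :* E) :+ (C₂ :+ Θ) :* ((W :* S) :* E))
                 refl (share s t) (ws s) (c s t) (c t v) (θ v) (f s) (spread s t v) ⟩
      K * (share s t * spread s t v) + (c t v + θ v) * ((ws s * share s t) * spread s t v)
        ≡⟨ cong (λ z → K * (share s t * spread s t v) + (c t v + θ v) * (z * spread s t v)) (ws*share s t ls) ⟩
      K * (share s t * spread s t v) + (c t v + θ v) * (w s t * spread s t v) ∎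

  pair-cost≤ : ∀ s t → L s ≡ true →
    chatT s t * ifq (s ==F primary t) (share s t)
      + ifq (not (s ==F primary t)) (share s t * sumOver (otherLight s) (λ v → chatL s v * spread s t v))
    ≤ w s t * c s t + ifq (s ==F primary t) (f t * share s t)
      + ifq (not (s ==F primary t)) (rerouteCost s t) - f s * share s t
  pair-cost≤ s t ls with s ==F primary t in s==primary
  ... | true  = ≤-reflexive (begin
      chatT s t * share s t + 0ℚ
        ≡⟨ solve 5 (λ W C Ft Fs S → (W :* C :+ Ft :- Fs) :* S :+ con 0ℚ
                      := (W :* S) :* C :+ Ft :* S :+ con 0ℚ :- Fs :* S) refl (ws s) (c s t) (f t) (f s) (share s t) ⟩
      (ws s * share s t) * c s t + f t * share s t + 0ℚ - f s * share s t
        ≡⟨ cong (λ z → z * c s t + f t * share s t + 0ℚ - f s * share s t) (ws*share s t ls) ⟩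
      w s t * c s t + f t * share s t + 0ℚ - f s * share s t ∎)
    where open ≡-Reasoning
  ... | false = begin
      chatT s t * 0ℚ + X                                   ≡⟨ solve 2 (λ A X → A :* con 0ℚ :+ X := X) refl (chatT s t) X ⟩
      X                                                    ≤⟨ rerouted-cost≤ s t ls s==primary ⟩
      w s t * c s t - f s * share s t + rerouteCost s t    ≡⟨ solve 3 (λ A B R → A :- B :+ R := A :+ con 0ℚ :+ R :- B)
                                                                     refl (w s t * c s t) (f s * share s t) (rerouteCost s t) ⟩
      w s t * c s t + 0ℚ + rerouteCost s t - f s * share s t ∎
    where
    open ≤-Reasoning
    X = share s t * sumOver (otherLight s) (λ v → chatL s v * spread s t v)

  directCost primaryCost reroutedCost : Fin n → ℚ
  directCost   s = sumOver T (λ t → w s t * c s t)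
  primaryCost  s = sumOver T (λ t → ifq (s ==F primary t) (f t * share s t))
  reroutedCost s = sumOver T (λ t → ifq (not (s ==F primary t)) (rerouteCost s t))

  row-cost≤ : ∀ s → L s ≡ true →
    sumFin (λ t → ifq ((T t ∨ L t) ∧ not (s ==F t)) (chat s t * y s t)) ≤
    directCost s + primaryCost s + reroutedCost s - f s
  row-cost≤ s ls = begin
    sumFin (λ v → ifq ((T v ∨ L v) ∧ not (s ==F v)) (chat s v * y s v))
      ≡⟨ sumFin-cong (λ v → objective-term s v ls) ⟩
    sumFin (λ v → ifq (T v) (chatT s v * yT s v) + ifq (otherLight s v) (chatL s v * yL s v))
      ≡⟨ sumFin-+ (λ v → ifq (T v) (chatT s v * yT s v)) (λ v → ifq (otherLight s v) (chatL s v * yL s v)) ⟩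
    sumOver T (λ t → chatT s t * yT s t) + sumOver (otherLight s) (λ v → chatL s v * yL s v)
      ≡⟨ cong (sumOver T (λ t → chatT s t * yT s t) +_) (sumOver-yL s (chatL s)) ⟩
    sumOver T (λ t → chatT s t * yT s t) + sumOver T rerouted
      ≡⟨ sumOver-+ T (λ t → chatT s t * yT s t) rerouted ⟨
    sumOver T (λ t → chatT s t * yT s t + rerouted t)
      ≤⟨ sumOver-mono T (λ t _ → pair-cost≤ s t ls) ⟩
    sumOver T (λ t → w s t * c s t + ifq (s ==F primary t) (f t * share s t)
                       + ifq (not (s ==F primary t)) (rerouteCost s t) - f s * share s t)
      ≡⟨ sumOver-f+g+h-k T (λ t → w s t * c s t) (λ t → ifq (s ==F primary t) (f t * share s t))
                           (λ t → ifq (not (s ==F primary t)) (rerouteCost s t)) (λ t → f s * share s t) ⟩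
    directCost s + primaryCost s + reroutedCost s - sumOver T (λ t → f s * share s t)
      ≡⟨ cong (λ z → directCost s + primaryCost s + reroutedCost s - z)
              (trans (sumOver-*ˡ T (f s) (share s)) (trans (cong (f s *_) (sumOver-share s ls)) (*-identityʳ (f s)))) ⟩
    directCost s + primaryCost s + reroutedCost s - f s ∎
    where
    open ≤-Reasoning
    rerouted : Fin n → ℚ
    rerouted t = ifq (not (s ==F primary t)) (share s t * sumOver (otherLight s) (λ v → chatL s v * spread s t v))

  sumOver-primaryCost≤ : sumOver L primaryCost ≤ sumOver T f
  sumOver-primaryCost≤ = begin
    sumOver L primaryCost
      ≡⟨ sumFin-cong (λ s → ifq-sumFin (L s) (λ t → ifq (T t) (ifq (s ==F primary t) (f t * share s t)))) ⟩
    sumFin (λ s → sumFin (λ t → ifq (L s) (ifq (T t) (ifq (s ==F primary t) (f t * share s t)))))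
      ≡⟨ sumFin-swap (λ s t → ifq (L s) (ifq (T t) (ifq (s ==F primary t) (f t * share s t)))) ⟩
    sumFin (λ t → sumFin (λ s → ifq (L s) (ifq (T t) (ifq (s ==F primary t) (f t * share s t)))))
      ≡⟨ sumFin-cong (λ t → trans (sumFin-cong (λ s → rotate (L s) (T t) (s ==F primary t) (f t * share s t)))
                                  (sym (ifq-sumFin (T t) (λ s → ifq (s ==F primary t) (ifq (L s) (f t * share s t)))))) ⟩
    sumOver T (λ t → sumFin (λ s → ifq (s ==F primary t) (ifq (L s) (f t * share s t))))
      ≡⟨ sumFin-cong (λ t → cong (ifq (T t)) (sumFin-pickʳ (primary t) (λ s → ifq (L s) (f t * share s t)))) ⟩
    sumOver T (λ t → ifq (L (primary t)) (f t * share (primary t) t))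
      ≤⟨ sumOver-mono T (λ t tt → ≤-trans (ifq-monoᵗ (L (primary t)) (λ lm →
            ≤-trans (*-monoˡ-≤-0≤ (f-nonNeg t) (share≤1 (primary t) t lm tt)) (≤-reflexive (*-identityʳ (f t)))))
            (ifq≤ (L (primary t)) (f-nonNeg t))) ⟩
    sumOver T f ∎
    where
    open ≤-Reasoning
    rotate : ∀ a b d x → ifq a (ifq b (ifq d x)) ≡ ifq b (ifq d (ifq a x))
    rotate a b d x = trans (ifq-comm a b (ifq d x)) (cong (ifq b) (ifq-comm a d x))

  reroutedWeight : Fin n → Fin n → Fin n → ℚ
  reroutedWeight t v s = ifq (L s ∧ (not (s ==F primary t) ∧ not (s ==F v))) (w s t)

  sumFin-reroutedWeight≤lwExcept : ∀ t v u → sumFin (reroutedWeight t v) ≤ lwExcept u t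
  sumFin-reroutedWeight≤lwExcept t v u = +-cancelˡ-≤ (lw t u) (begin
    lw t u + sumFin (reroutedWeight t v)
      ≤⟨ +-mono-≤ (lw≤lw-primary t u) (sumFin-mono (λ x → ≤-trans (weaken (L x) (not (x ==F m)) (not (x ==F v)) (w-nonNeg x t))
                                                      (≤-reflexive (cong (λ b → ifq (not b) (lw t x)) (==F-sym x m))))) ⟩
    lw t m + sumFin (λ x → ifq (not (m ==F x)) (lw t x))
      ≡⟨ sumFin-split m (lw t) ⟨
    sumFin (lw t)
      ≡⟨ sumFin-split u (lw t) ⟩
    lw t u + sumFin (λ x → ifq (not (u ==F x)) (lw t x))
      ≡⟨ cong (lw t u +_) (sumFin-cong (λ x → trans (ifq-comm (not (u ==F x)) (L x) (w x t)) (sym (ifq-∧ (L x) _ (w x t))))) ⟩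
    lw t u + lwExcept u t ∎)
    where
    open ≤-Reasoning
    m = primary t
    weaken : ∀ a b d {p} → 0ℚ ≤ p → ifq (a ∧ (b ∧ d)) p ≤ ifq b (ifq a p)
    weaken true  true  d 0≤p = ifq≤ d 0≤p
    weaken true  false d 0≤p = ≤-refl
    weaken false b     d 0≤p = ≤-reflexive (sym (ifq-0 b))

  rerouted-mass≤1 : ∀ t v → sumFin (λ s → reroutedWeight t v s * inv (lwExcept s t)) ≤ 1ℚ
  rerouted-mass≤1 t v = sumFin-ratio≤1 (reroutedWeight t v) (λ s → lwExcept s t)
                          (λ s → ifq-nonNeg (L s ∧ _) (w-nonNeg s t)) (sumFin-reroutedWeight≤lwExcept t v)

  detour-charge≤ : ∀ v → L v ≡ true → sumOver T (λ t → (c t v + θ v) * w v t) ≤ vS v + vR v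
  detour-charge≤ v lv = begin
    sumOver T (λ t → (c t v + θ v) * w v t)
      ≡⟨ sumOver-cong T (λ t _ → trans (cong (λ z → (z + θ v) * w v t) (c-sym t v))
                                       (solve 3 (λ C Θ W → (C :+ Θ) :* W := W :* C :+ Θ :* W) refl (c v t) (θ v) (w v t))) ⟩
    sumOver T (λ t → w v t * c v t + θ v * w v t)
      ≡⟨ trans (sumOver-+ T (λ t → w v t * c v t) (λ t → θ v * w v t)) (cong (directCost v +_) (sumOver-*ˡ T (θ v) (w v))) ⟩
    directCost v + θ v * sumOver T (w v)
      ≤⟨ +-mono-≤ (vS-charge v lv) (≤-reflexive (trans (cong (θ v *_) (ws-row v lv)) (*-comm (θ v) (ws v)))) ⟩
    vS v + ws v * θ v
      ≤⟨ +-monoʳ-≤ (vS v) (vR-charge v lv) ⟩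
    vS v + vR v ∎
    where open ≤-Reasoning

  sumOver-reroutedCost≤ : sumOver L reroutedCost ≤ sumOver L (λ v → vS v + vR v)
  sumOver-reroutedCost≤ = begin
    sumOver L reroutedCost
      ≡⟨ sumFin-cong (λ s → trans (ifq-sumFin (L s) (λ t → ifq (T t) (ifq (not (s ==F primary t)) (rerouteCost s t))))
                                  (sumFin-cong (λ t →
           ifq³-sumFin (L s) (T t) (not (s ==F primary t)) (λ v → ifq (otherLight s v) (E s t v))))) ⟩
    sumFin (λ s → sumFin (λ t → sumFin (λ v → F s t v)))
      ≡⟨ sumFin-swap (λ s t → sumFin (F s t)) ⟩
    sumFin (λ t → sumFin (λ s → sumFin (λ v → F s t v)))
      ≡⟨ sumFin-cong (λ t → sumFin-swap (λ s v → F s t v)) ⟩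
    sumFin (λ t → sumFin (λ v → sumFin (λ s → F s t v)))
      ≡⟨ sumFin-cong (λ t → sumFin-cong (λ v →
           trans (sumFin-cong (λ s → factor (L s) (T t) (not (s ==F primary t)) (L v) (not (s ==F v))
                                            (c t v + θ v) (w s t) (w v t) (inv (lwExcept s t))))
                 (sumFin-*ˡ (P t v) (λ s → reroutedWeight t v s * inv (lwExcept s t))))) ⟩
    sumFin (λ t → sumFin (λ v → P t v * sumFin (λ s → reroutedWeight t v s * inv (lwExcept s t))))
      ≤⟨ sumFin-mono (λ t → sumFin-mono (λ v → ≤-trans (*-monoˡ-≤-0≤ (P-nonNeg t v) (rerouted-mass≤1 t v))
                                                       (≤-reflexive (*-identityʳ (P t v))))) ⟩
    sumFin (λ t → sumFin (λ v → P t v))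
      ≡⟨ sumFin-swap P ⟩
    sumFin (λ v → sumFin (λ t → P t v))
      ≡⟨ sumFin-cong (λ v → trans (sumFin-cong (λ t → ifq-comm (T t) (L v) ((c t v + θ v) * w v t)))
                                  (sym (ifq-sumFin (L v) (λ t → ifq (T t) ((c t v + θ v) * w v t))))) ⟩
    sumOver L (λ v → sumOver T (λ t → (c t v + θ v) * w v t))
      ≤⟨ sumOver-mono L detour-charge≤ ⟩
    sumOver L (λ v → vS v + vR v) ∎
    where
    open ≤-Reasoning
    E F : Fin n → Fin n → Fin n → ℚ
    E s t v = (c t v + θ v) * (w s t * spread s t v)
    F s t v = ifq (L s) (ifq (T t) (ifq (not (s ==F primary t)) (ifq (otherLight s v) (E s t v))))
    P : Fin n → Fin n → ℚ
    P t v = ifq (T t) (ifq (L v) ((c t v + θ v) * w v t))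
    P-nonNeg : ∀ t v → 0ℚ ≤ P t v
    P-nonNeg t v = ifq-nonNeg (T t) (ifq-nonNegᵗ (L v) (λ lv → *-nonNeg (+-nonNeg (c-nonNeg t v) (θ-nonNeg v lv)) (w-nonNeg v t)))
    ifq³-sumFin : ∀ a b d (g : Fin n → ℚ) → ifq a (ifq b (ifq d (sumFin g))) ≡ sumFin (λ v → ifq a (ifq b (ifq d (g v))))
    ifq³-sumFin a b d g = trans (cong (ifq a) (trans (cong (ifq b) (ifq-sumFin d g)) (ifq-sumFin b (λ v → ifq d (g v)))))
                                (ifq-sumFin a (λ v → ifq b (ifq d (g v))))
    factor : ∀ ls tt nm lv nv C W X I →
             ifq ls (ifq tt (ifq nm (ifq (lv ∧ nv) (C * (W * (X * I)))))) ≡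
             ifq tt (ifq lv (C * X)) * (ifq (ls ∧ (nm ∧ nv)) W * I)
    factor false tt    nm    lv    nv    C W X I = sym (trans (cong (ifq tt (ifq lv (C * X)) *_) (*-zeroˡ I))
                                                              (*-zeroʳ (ifq tt (ifq lv (C * X)))))
    factor true  false nm    lv    nv    C W X I = sym (*-zeroˡ (ifq (nm ∧ nv) W * I))
    factor true  true  false lv    nv    C W X I = sym (trans (cong (ifq lv (C * X) *_) (*-zeroˡ I)) (*-zeroʳ (ifq lv (C * X))))
    factor true  true  true  false nv    C W X I = sym (*-zeroˡ (ifq nv W * I))
    factor true  true  true  true  false C W X I = sym (trans (cong ((C * X) *_) (*-zeroˡ I)) (*-zeroʳ (C * X)))
    factor true  true  true  true  true  C W X I = solve 4 (λ C W X I → C :* (W :* (X :* I)) := (C :* X) :* (W :* I)) refl C W X I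

  objective≤ : objective y ≤ (1ℚ + 1ℚ) * sumOver L vS + sumOver L vR - sumOver L f + sumOver T f
  objective≤ = begin
    objective y
      ≤⟨ sumOver-mono L row-cost≤ ⟩
    sumOver L (λ s → directCost s + primaryCost s + reroutedCost s - f s)
      ≡⟨ sumOver-f+g+h-k L directCost primaryCost reroutedCost f ⟩
    sumOver L directCost + sumOver L primaryCost + sumOver L reroutedCost - sumOver L f
      ≤⟨ +-monoˡ-≤ (- sumOver L f) (+-mono-≤ (+-mono-≤ (sumOver-mono L vS-charge) sumOver-primaryCost≤) sumOver-reroutedCost≤) ⟩
    sumOver L vS + sumOver T f + sumOver L (λ v → vS v + vR v) - sumOver L f
      ≡⟨ cong (λ z → sumOver L vS + sumOver T f + z - sumOver L f) (sumOver-+ L vS vR) ⟩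
    sumOver L vS + sumOver T f + (sumOver L vS + sumOver L vR) - sumOver L f
      ≡⟨ solve 4 (λ S F R G → S :+ F :+ (S :+ R) :- G := (con 1ℚ :+ con 1ℚ) :* S :+ R :- G :+ F)
               refl (sumOver L vS) (sumOver T f) (sumOver L vR) (sumOver L f) ⟩
    (1ℚ + 1ℚ) * sumOver L vS + sumOver L vR - sumOver L f + sumOver T f ∎
    where open ≤-Reasoning

-- Paths

module _ {nF nC : ℕ} where

  Steps : Set
  Steps = List (Fin nC × FNode nF)

  fwdCount-nonNeg : ∀ prev (st : Steps) a j → 0ℚ ≤ fwdCount prev st a j
  fwdCount-nonNeg prev []             a j = ≤-refl
  fwdCount-nonNeg prev ((j′ , b) ∷ st) a j = +-nonNeg (ifq-nonNeg ((prev ==N a) ∧ (j′ ==F j)) 0≤1) (fwdCount-nonNeg b st a j)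

  bwdCount-nonNeg : ∀ prev (st : Steps) a j → 0ℚ ≤ bwdCount prev st a j
  bwdCount-nonNeg prev []             a j = ≤-refl
  bwdCount-nonNeg prev ((j′ , b) ∷ st) a j = +-nonNeg (ifq-nonNeg ((b ==N a) ∧ (j′ ==F j)) 0≤1) (bwdCount-nonNeg b st a j)

  sumFin-ifq-∧-==F : ∀ b (j′ : Fin nC) → sumFin (λ j → ifq (b ∧ (j′ ==F j)) 1ℚ) ≡ ifq b 1ℚ
  sumFin-ifq-∧-==F b j′ = trans (sumFin-cong (λ j → ifq-∧ b (j′ ==F j) 1ℚ))
                         (trans (sym (ifq-sumFin b (λ j → ifq (j′ ==F j) 1ℚ))) (cong (ifq b) (sumFin-pick j′ (λ _ → 1ℚ))))

  net-departures : ∀ prev (st : Steps) a →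
    sumFin (λ j → fwdCount prev st a j - bwdCount prev st a j) ≡ ifq (prev ==N a) 1ℚ - ifq (endFrom prev st ==N a) 1ℚ
  net-departures prev [] a = trans (sumFin-zero {nC} (λ _ → +-inverseʳ 0ℚ)) (sym (+-inverseʳ (ifq (prev ==N a) 1ℚ)))
  net-departures prev ((j′ , b) ∷ st) a = begin
    sumFin (λ j → (out j + fwdCount b st a j) - (in′ j + bwdCount b st a j))
      ≡⟨ sumFin-cong (λ j → solve 4 (λ O F I B → (O :+ F) :- (I :+ B) := (O :- I) :+ (F :- B))
                                    refl (out j) (fwdCount b st a j) (in′ j) (bwdCount b st a j)) ⟩
    sumFin (λ j → (out j - in′ j) + (fwdCount b st a j - bwdCount b st a j))
      ≡⟨ sumFin-+ (λ j → out j - in′ j) (λ j → fwdCount b st a j - bwdCount b st a j) ⟩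
    sumFin (λ j → out j - in′ j) + sumFin (λ j → fwdCount b st a j - bwdCount b st a j)
      ≡⟨ cong₂ _+_ (trans (sumFin-- out in′) (cong₂ _-_ (sumFin-ifq-∧-==F (prev ==N a) j′) (sumFin-ifq-∧-==F (b ==N a) j′)))
                   (net-departures b st a) ⟩
    (ifq (prev ==N a) 1ℚ - ifq (b ==N a) 1ℚ) + (ifq (b ==N a) 1ℚ - ifq (endFrom b st ==N a) 1ℚ)
      ≡⟨ solve 3 (λ P B E → (P :- B) :+ (B :- E) := P :- E)
                 refl (ifq (prev ==N a) 1ℚ) (ifq (b ==N a) 1ℚ) (ifq (endFrom b st ==N a) 1ℚ) ⟩
    ifq (prev ==N a) 1ℚ - ifq (endFrom b st ==N a) 1ℚ ∎
    where
    open ≡-Reasoning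
    out in′ : Fin nC → ℚ
    out j = ifq ((prev ==N a) ∧ (j′ ==F j)) 1ℚ
    in′ j = ifq ((b ==N a) ∧ (j′ ==F j)) 1ℚ

  record NoLanding (a prev : FNode nF) (st : Steps) : Set where
    constructor noLanding
    field bwdCount≡0 : ∀ j → bwdCount prev st a j ≡ 0ℚ

  record NoDeparture (a prev : FNode nF) (st : Steps) : Set where
    constructor noDeparture
    field fwdCount≡0 : ∀ j → fwdCount prev st a j ≡ 0ℚ

  private
    leading-indicator-false : ∀ b (j′ : Fin nC) {rest} → 0ℚ ≤ rest → ifq (b ∧ (j′ ==F j′)) 1ℚ + rest ≡ 0ℚ → b ≡ false
    leading-indicator-false b j′ 0≤rest sum≡0 =
      ifq-1≡0 b (trans (cong (λ z → ifq z 1ℚ) (sym (trans (cong (b ∧_) (==F-refl j′)) (∧-identityʳ b))))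
                       (p+q≡0⇒p≡0 (ifq-nonNeg _ 0≤1) 0≤rest sum≡0))
      where
      ifq-1≡0 : ∀ b → ifq b 1ℚ ≡ 0ℚ → b ≡ false
      ifq-1≡0 true  1≡0 = contradiction 1≡0 1≢0
      ifq-1≡0 false _   = refl

  NoLanding-∷ : ∀ {a prev j′ b rest} → NoLanding a prev ((j′ , b) ∷ rest) → (b ==N a) ≡ false × NoLanding a b rest
  NoLanding-∷ {a} {prev} {j′} {b} {rest} (noLanding h) =
      leading-indicator-false (b ==N a) j′ (bwdCount-nonNeg b rest a j′) (h j′)
    , noLanding (λ j → p+q≡0⇒q≡0 (ifq-nonNeg ((b ==N a) ∧ (j′ ==F j)) 0≤1) (bwdCount-nonNeg b rest a j) (h j))

  NoDeparture-∷ : ∀ {a prev j′ b rest} → NoDeparture a prev ((j′ , b) ∷ rest) → (prev ==N a) ≡ false × NoDeparture a b rest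
  NoDeparture-∷ {a} {prev} {j′} {b} {rest} (noDeparture h) =
      leading-indicator-false (prev ==N a) j′ (fwdCount-nonNeg b rest a j′) (h j′)
    , noDeparture (λ j → p+q≡0⇒q≡0 (ifq-nonNeg ((prev ==N a) ∧ (j′ ==F j)) 0≤1) (fwdCount-nonNeg b rest a j) (h j))

module _ {nF nC : ℕ} (I : Instance nF nC) where
  open Instance I
  open IsMetric metric

  dist≤pathCost : ∀ {prev} i e (st : Steps) → prev ≡ fac i → NoLanding nodeN prev st → NoDeparture nodeN* prev st →
                  endFrom prev st ≡ fac e → cFF I i e ≤ pathCostFrom I prev st
  dist≤pathCost i .i []                     refl _   _    refl = ≤-reflexive (self (inj₁ i))
  dist≤pathCost i e  ((j , fac b) ∷ rest)    refl noN noN* end≡e = begin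
    dist (inj₁ i) (inj₁ e)
      ≤⟨ tri (inj₁ i) (inj₂ j) (inj₁ e) ⟩
    dist (inj₁ i) (inj₂ j) + dist (inj₂ j) (inj₁ e)
      ≤⟨ +-monoʳ-≤ (dist (inj₁ i) (inj₂ j)) (tri (inj₂ j) (inj₁ b) (inj₁ e)) ⟩
    dist (inj₁ i) (inj₂ j) + (dist (inj₂ j) (inj₁ b) + dist (inj₁ b) (inj₁ e))
      ≤⟨ +-monoʳ-≤ (dist (inj₁ i) (inj₂ j)) (+-mono-≤ (≤-reflexive (symm (inj₂ j) (inj₁ b)))
           (dist≤pathCost b e rest refl (proj₂ (NoLanding-∷ noN)) (proj₂ (NoDeparture-∷ noN*)) end≡e)) ⟩
    dist (inj₁ i) (inj₂ j) + (dist (inj₁ b) (inj₂ j) + pathCostFrom I (fac b) rest)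
      ≡⟨ +-assoc (dist (inj₁ i) (inj₂ j)) (dist (inj₁ b) (inj₂ j)) (pathCostFrom I (fac b) rest) ⟨
    pathCostFrom I (fac i) ((j , fac b) ∷ rest) ∎
    where open ≤-Reasoning
  dist≤pathCost i e ((j , nodeN) ∷ rest)              refl noN _    _ = contradiction (proj₁ (NoLanding-∷ noN)) λ ()
  dist≤pathCost i e ((j , nodeN*) ∷ [])               refl _   _    ()
  dist≤pathCost i e ((j , nodeN*) ∷ (j₂ , b₂) ∷ rest) refl _   noN* _ =
    contradiction (proj₁ (NoDeparture-∷ (proj₂ (NoDeparture-∷ noN*)))) λ ()

  ucost-nonNeg : ∀ a j → 0ℚ ≤ ucost I a j
  ucost-nonNeg (fac i) j = nonneg (inj₁ i) (inj₂ j)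
  ucost-nonNeg nodeN   j = pen≥0 j
  ucost-nonNeg nodeN*  j = pen≥0 j

  pathCostFrom-nonNeg : ∀ prev (st : Steps) → 0ℚ ≤ pathCostFrom I prev st
  pathCostFrom-nonNeg prev []             = ≤-refl
  pathCostFrom-nonNeg prev ((j , b) ∷ st) = +-nonNeg (+-nonNeg (ucost-nonNeg prev j) (ucost-nonNeg b j)) (pathCostFrom-nonNeg b st)

-- The path decomposition

module Decomposition {nF nC : ℕ} (I : Instance nF nC)
  (S : FSet nF) (x : Fin nF → Fin nC → ℚ) (S* : FSet nF) (x* : Fin nF → Fin nC → ℚ)
  (P : List (WPath nF nC))
  (x-assignment : IsAssignment I S x) (x*-assignment : IsAssignment I S* x*)
  (pd : IsPathDecomposition I S x S* x* P) where

  open Instance I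
  open Setup I S x S* x* P
  module PD = IsPathDecomposition pd
  module X  = IsAssignment x-assignment
  module X* = IsAssignment x*-assignment

  weight-nonNeg : All (λ q → 0ℚ ≤ weight q) P
  weight-nonNeg = All.map <⇒≤ PD.positive

  wOf-nonNeg : ∀ sel → 0ℚ ≤ wOf sel
  wOf-nonNeg sel = sumList-nonNegᴬ (All.map (λ {q} → ifq-nonNeg (sel q)) weight-nonNeg)

  vOf-nonNeg : ∀ sel → 0ℚ ≤ vOf sel
  vOf-nonNeg sel = sumList-nonNegᴬ (All.map (λ {q} 0≤w → ifq-nonNeg (sel q) (*-nonNeg 0≤w (pathCostFrom-nonNeg I (start q) (steps q))))
                                            weight-nonNeg)

  weighted-count≡0 : (count : WPath nF nC → Fin nC → ℚ) → (∀ q j → 0ℚ ≤ count q j) →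
                     (∀ j → sumList (λ q → weight q * count q j) P ≡ 0ℚ) → All (λ q → ∀ j → count q j ≡ 0ℚ) P
  weighted-count≡0 count 0≤count Σ≡0 = ∀-All⇒All-∀ (λ j →
    All.zipWith (λ (0<w , w*count≡0) → p*q≡0⇒q≡0 0<w w*count≡0)
      (PD.positive , sumList≡0⇒All≡0 (All.map (λ {q} 0<w → *-nonNeg (<⇒≤ 0<w) (0≤count q j)) PD.positive) (Σ≡0 j)))

  -- x serves at most the demand and x* as well, so the flow is nonnegative on the edges of N
  -- and nonpositive on those of N*: no path enters N or leaves N*.
  no-landing-at-N : All (λ q → NoLanding nodeN (start q) (steps q)) P
  no-landing-at-N = All.map noLanding (weighted-count≡0 (λ q → bwdCount (start q) (steps q) nodeN)
    (λ q → bwdCount-nonNeg (start q) (steps q) nodeN) (λ j → proj₁ (PD.conformP nodeN j (p≤q⇒0≤q-p (X.demand j)))))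

  no-departure-from-N* : All (λ q → NoDeparture nodeN* (start q) (steps q)) P
  no-departure-from-N* = All.map noDeparture (weighted-count≡0 (λ q → fwdCount (start q) (steps q) nodeN*)
    (λ q → fwdCount-nonNeg (start q) (steps q) nodeN*) (λ j → fwdW≡0 j (0ℚ ≤? flow I x x* nodeN* j)))
    where
    fwdW≡0 : ∀ j → Dec (0ℚ ≤ flow I x x* nodeN* j) → PD.fwdW nodeN* j ≡ 0ℚ
    fwdW≡0 j (yes 0≤flow) = ≤-antisym
      (≤-trans (proj₂ (PD.conformP nodeN* j 0≤flow)) (neg-antimono-≤ (p≤q⇒0≤q-p (X*.demand j))))
      (sumList-nonNegᴬ (All.map (λ {q} 0<w → *-nonNeg (<⇒≤ 0<w) (fwdCount-nonNeg (start q) (steps q) nodeN* j)) PD.positive))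
    fwdW≡0 j (no flow≱0)  = proj₁ (PD.conformN nodeN* j (≰⇒> flow≱0))

  end-classes : ∀ q → inSN* I S* (pathEnd q) ≡ true →
                ExactlyOne (endsIn S*minusS q) (endsIn SandS* q) (endsAtN* q)
  end-classes q ends with pathEnd q
  ... | fac e  = by-membership (S e) (S* e) ends
    where
    by-membership : ∀ a b → b ≡ true → ExactlyOne (b ∧ not a) (a ∧ b) false
    by-membership true  true _ = second
    by-membership false true _ = first
  ... | nodeN* = third

  pathEnd≢fac : ∀ u (q : WPath nF nC) → S* u ≡ false → inSN* I S* (pathEnd q) ≡ true → (pathEnd q ==N fac u) ≡ false
  pathEnd≢fac u q S*u≡false ends with pathEnd q
  ... | nodeN* = refl
  ... | fac e with e ==F u in e==u
  ...   | false = refl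
  ...   | true  = contradiction (trans (sym ends) (trans (cong S* (==F⇒≡ e==u)) S*u≡false)) λ ()

  ∉S* : ∀ {u} → SminusS* u ≡ true → S* u ≡ false
  ∉S* {u} u∈S∖S* = not≡true⇒≡false (proj₂ (∧≡true {S u} u∈S∖S*))

  sumFin-net-outflow : ∀ a → sumFin (λ j → PD.fwdW a j - PD.bwdW a j) ≡
                       sumList (λ q → weight q * (ifq (start q ==N a) 1ℚ - ifq (pathEnd q ==N a) 1ℚ)) P
  sumFin-net-outflow a = begin
    sumFin (λ j → PD.fwdW a j - PD.bwdW a j)
      ≡⟨ sumFin-cong (λ j → sym (trans (sumList-cong P (λ q → *-distribˡ-- (weight q) (fwd q j) (bwd q j)))
                                       (sumList-- (λ q → weight q * fwd q j) (λ q → weight q * bwd q j) P))) ⟩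
    sumFin (λ j → sumList (λ q → weight q * (fwd q j - bwd q j)) P)
      ≡⟨ sumList-sumFin (λ q j → weight q * (fwd q j - bwd q j)) P ⟨
    sumList (λ q → sumFin (λ j → weight q * (fwd q j - bwd q j))) P
      ≡⟨ sumList-cong P (λ q → trans (sumFin-*ˡ (weight q) (λ j → fwd q j - bwd q j))
                                     (cong (weight q *_) (net-departures (start q) (steps q) a))) ⟩
    sumList (λ q → weight q * (ifq (start q ==N a) 1ℚ - ifq (pathEnd q ==N a) 1ℚ)) P ∎
    where
    open ≡-Reasoning
    fwd bwd : WPath nF nC → Fin nC → ℚ
    fwd q = fwdCount (start q) (steps q) a
    bwd q = bwdCount (start q) (steps q) a
    *-distribˡ-- : ∀ w a b → w * (a - b) ≡ w * a - w * b
    *-distribˡ-- w a b = solve 3 (λ w a b → w :* (a :- b) := w :* a :- w :* b) refl w a b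

  net-outflow-by-class : ∀ u q → SminusS* u ≡ true → inSN* I S* (pathEnd q) ≡ true →
    weight q * (ifq (startsAt u q) 1ℚ - ifq (pathEnd q ==N fac u) 1ℚ) ≡
    ifq (inSw u q) (weight q) + ifq (inTr u q) (weight q) + ifq (inPen u q) (weight q)
  net-outflow-by-class u q u∈S∖S* ends = begin
    weight q * (ifq (startsAt u q) 1ℚ - ifq (pathEnd q ==N fac u) 1ℚ)
      ≡⟨ cong (λ b → weight q * (ifq (startsAt u q) 1ℚ - ifq b 1ℚ)) (pathEnd≢fac u q (∉S* u∈S∖S*) ends) ⟩
    weight q * (ifq (startsAt u q) 1ℚ - 0ℚ)
      ≡⟨ solve 2 (λ w i → w :* (i :- con 0ℚ) := i :* w) refl (weight q) (ifq (startsAt u q) 1ℚ) ⟩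
    ifq (startsAt u q) 1ℚ * weight q
      ≡⟨ trans (sym (ifq-*ʳ (startsAt u q) (weight q) 1ℚ)) (cong (ifq (startsAt u q)) (*-identityˡ (weight q))) ⟩
    ifq (startsAt u q) (weight q)
      ≡⟨ ifq-partition (startsAt u q) (weight q) (end-classes q ends) ⟩
    ifq (startsAt u q ∧ endsIn S*minusS q) (weight q) + ifq (startsAt u q ∧ endsIn SandS* q) (weight q)
      + ifq (startsAt u q ∧ endsAtN* q) (weight q)
      ≡⟨ cong (λ b → ifq (b ∧ (startsAt u q ∧ endsIn S*minusS q)) (weight q) + ifq (b ∧ (startsAt u q ∧ endsIn SandS* q)) (weight q)
                       + ifq (b ∧ (startsAt u q ∧ endsAtN* q)) (weight q)) (sym u∈S∖S*) ⟩
    ifq (inSw u q) (weight q) + ifq (inTr u q) (weight q) + ifq (inPen u q) (weight q) ∎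
    where open ≡-Reasoning

  sumFin-x≡wSw+wTr+wPen : ∀ u → SminusS* u ≡ true → sumFin (x u) ≡ wSw u + wTr u + wPen u
  sumFin-x≡wSw+wTr+wPen u u∈S∖S* = begin
    sumFin (x u)
      ≡⟨ sumFin-cong (λ j → sym (trans (cong (λ z → x u j - z) (X*.outside u j (∉S* u∈S∖S*))) (+-identityʳ (x u j)))) ⟩
    sumFin (flow I x x* (fac u))
      ≡⟨ p-q≡0⇒p≡q (trans (sym (sumFin-- (flow I x x* (fac u)) (λ j → PD.fwdW (fac u) j - PD.bwdW (fac u) j)))
                         (PD.circFac (fac u))) ⟩
    sumFin (λ j → PD.fwdW (fac u) j - PD.bwdW (fac u) j)
      ≡⟨ sumFin-net-outflow (fac u) ⟩
    sumList (λ q → weight q * (ifq (startsAt u q) 1ℚ - ifq (pathEnd q ==N fac u) 1ℚ)) P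
      ≡⟨ sumList-congᴬ (All.map (λ {q} → net-outflow-by-class u q u∈S∖S*) PD.ends) ⟩
    sumList (λ q → ifq (inSw u q) (weight q) + ifq (inTr u q) (weight q) + ifq (inPen u q) (weight q)) P
      ≡⟨ trans (sumList-+ (λ q → ifq (inSw u q) (weight q) + ifq (inTr u q) (weight q)) (λ q → ifq (inPen u q) (weight q)) P)
               (cong (_+ wPen u) (sumList-+ (λ q → ifq (inSw u q) (weight q)) (λ q → ifq (inTr u q) (weight q)) P)) ⟩
    wSw u + wTr u + wPen u ∎
    where open ≡-Reasoning

  sumOver-endsAt : ∀ A q b p → sumOver A (λ t → ifq (b ∧ (pathEnd q ==N fac t)) p) ≡ ifq (b ∧ endsIn A q) p
  sumOver-endsAt A q b p with pathEnd q
  ... | fac e  = begin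
    sumFin (λ t → ifq (A t) (ifq (b ∧ (e ==F t)) p))     ≡⟨ sumFin-cong (λ t → reorder (A t) b (e ==F t)) ⟩
    sumFin (λ t → ifq (e ==F t) (ifq (A t) (ifq b p)))   ≡⟨ sumFin-pick e (λ t → ifq (A t) (ifq b p)) ⟩
    ifq (A e) (ifq b p)                                  ≡⟨ ifq-comm (A e) b p ⟩
    ifq b (ifq (A e) p)                                  ≡⟨ ifq-∧ b (A e) p ⟨
    ifq (b ∧ A e) p                                      ∎
    where
    open ≡-Reasoning
    reorder : ∀ a b d → ifq a (ifq (b ∧ d) p) ≡ ifq d (ifq a (ifq b p))
    reorder a b d = trans (cong (ifq a) (ifq-∧ b d p)) (trans (ifq-comm a b (ifq d p))
                      (trans (cong (ifq b) (ifq-comm a d p)) (trans (ifq-comm b d (ifq a p)) (cong (ifq d) (ifq-comm b a p)))))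
  ... | nodeN  = never-at-a-facility
    where
    never-at-a-facility : sumOver A (λ t → ifq (b ∧ false) p) ≡ ifq (b ∧ false) p
    never-at-a-facility rewrite ∧-zeroʳ b = sumFin-zero (λ t → ifq-0 (A t))
  ... | nodeN* = never-at-a-facility
    where
    never-at-a-facility : sumOver A (λ t → ifq (b ∧ false) p) ≡ ifq (b ∧ false) p
    never-at-a-facility rewrite ∧-zeroʳ b = sumFin-zero (λ t → ifq-0 (A t))

  wst : Fin nF → Fin nF → ℚ
  wst s t = wOf (λ q → inSw s q ∧ (pathEnd q ==N fac t))

  wst-nonNeg : ∀ s t → 0ℚ ≤ wst s t
  wst-nonNeg s t = wOf-nonNeg (λ q → inSw s q ∧ (pathEnd q ==N fac t))

  sumOver-wst-by-end : ∀ s (h : WPath nF nC → ℚ) →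
    sumOver S*minusS (λ t → sumList (λ q → ifq (inSw s q ∧ (pathEnd q ==N fac t)) (h q)) P) ≡ sumList (λ q → ifq (inSw s q) (h q)) P
  sumOver-wst-by-end s h = begin
    sumOver S*minusS (λ t → sumList (λ q → ifq (inSw s q ∧ (pathEnd q ==N fac t)) (h q)) P)
      ≡⟨ sumFin-cong (λ t → ifq-sumList (S*minusS t) (λ q → ifq (inSw s q ∧ (pathEnd q ==N fac t)) (h q)) P) ⟩
    sumFin (λ t → sumList (λ q → ifq (S*minusS t) (ifq (inSw s q ∧ (pathEnd q ==N fac t)) (h q))) P)
      ≡⟨ sumList-sumFin (λ q t → ifq (S*minusS t) (ifq (inSw s q ∧ (pathEnd q ==N fac t)) (h q))) P ⟨
    sumList (λ q → sumOver S*minusS (λ t → ifq (inSw s q ∧ (pathEnd q ==N fac t)) (h q))) P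
      ≡⟨ sumList-cong P (λ q → trans (sumOver-endsAt S*minusS q (inSw s q) (h q))
                                     (cong (λ b → ifq b (h q)) (absorb (SminusS* s) (startsAt s q) (endsIn S*minusS q)))) ⟩
    sumList (λ q → ifq (inSw s q) (h q)) P ∎
    where
    open ≡-Reasoning
    absorb : ∀ a b d → (a ∧ (b ∧ d)) ∧ d ≡ a ∧ (b ∧ d)
    absorb false b d = refl
    absorb true  b d = trans (∧-assoc b d d) (cong (b ∧_) (∧-idem d))

  sumOver-wst≡wSw : ∀ s → sumOver S*minusS (wst s) ≡ wSw s
  sumOver-wst≡wSw s = sumOver-wst-by-end s weight

  sumOver-wst*cFF≤vSw : ∀ s → sumOver S*minusS (λ t → wst s t * cFF I s t) ≤ vSw s
  sumOver-wst*cFF≤vSw s = begin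
    sumOver S*minusS (λ t → wst s t * cFF I s t)
      ≡⟨ sumOver-cong S*minusS (λ t _ → trans (sym (sumList-*ʳ (cFF I s t) (λ q → ifq (sel t q) (weight q)) P))
                                              (sumList-cong P (λ q → sym (ifq-*ʳ (sel t q) (cFF I s t) (weight q))))) ⟩
    sumOver S*minusS (λ t → sumList (λ q → ifq (sel t q) (weight q * cFF I s t)) P)
      ≤⟨ sumOver-mono S*minusS (λ t _ → sumList-monoᴬ (All.zipWith (λ (0<w , noN , noN*) → dist≤cost t 0<w noN noN*)
                                                          (PD.positive , All.zip (no-landing-at-N , no-departure-from-N*)))) ⟩
    sumOver S*minusS (λ t → sumList (λ q → ifq (sel t q) (weight q * pathCost I q)) P)
      ≡⟨ sumOver-wst-by-end s (λ q → weight q * pathCost I q) ⟩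
    vSw s ∎
    where
    open ≤-Reasoning hiding (start)
    sel : Fin nF → WPath nF nC → Bool
    sel t q = inSw s q ∧ (pathEnd q ==N fac t)
    dist≤cost : ∀ t {q} → 0ℚ < weight q → NoLanding nodeN (start q) (steps q) → NoDeparture nodeN* (start q) (steps q) →
                ifq (sel t q) (weight q * cFF I s t) ≤ ifq (sel t q) (weight q * pathCost I q)
    dist≤cost t {q} 0<w noN noN* = ifq-monoᵗ (sel t q) (λ sel≡true →
      let sw , ends-at-t = ∧≡true {inSw s q} sel≡true
          starts-at-s    = proj₁ (∧≡true (proj₂ (∧≡true {SminusS* s} sw)))
      in *-monoˡ-≤-0≤ (<⇒≤ 0<w) (dist≤pathCost I s t (steps q) (==N⇒≡ starts-at-s) noN noN* (==N⇒≡ ends-at-t)))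

  light⇒∉S*∖S : ∀ s → isLight s ≡ true → S*minusS s ≡ false
  light⇒∉S*∖S s light = cong (_∧ not (S s)) (∉S* (proj₁ (∧≡true light)))

  bound-by-light-sums : (1ℚ + 1ℚ) * vSwL + sumOver isLight (λ u → vTr u + vPen u) - cf I isLight + cf I S*minusS ≡ bound
  bound-by-light-sums = begin
    (1ℚ + 1ℚ) * vSwL + sumOver isLight (λ u → vTr u + vPen u) - cf I isLight + cf I S*minusS
      ≡⟨ cong (λ z → (1ℚ + 1ℚ) * vSwL + z - cf I isLight + cf I S*minusS) (sumOver-+ isLight vTr vPen) ⟩
    (1ℚ + 1ℚ) * vSwL + (vTrL + vPenL) - cf I isLight + cf I S*minusS
      ≡⟨ cong (λ z → z - cf I isLight + cf I S*minusS) (+-assoc ((1ℚ + 1ℚ) * vSwL) vTrL vPenL) ⟨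
    bound ∎
    where open ≡-Reasoning

  module _ (u : Fin nF) (light : isLight u ≡ true) where

    private
      from-⌊⌋ : ∀ {A : Set} (a? : Dec A) → ⌊ a? ⌋ ≡ true → A
      from-⌊⌋ (yes a) _ = a

      u∈S∖S* : SminusS* u ≡ true
      u∈S∖S* = proj₁ (∧≡true light)

      wSw-bounds : ⌊ 0ℚ <? wSw u ⌋ ≡ true × ⌊ wSw u <? U/2 ⌋ ≡ true
      wSw-bounds = ∧≡true (proj₂ (∧≡true {SminusS* u} light))

    wSw-pos : 0ℚ < wSw u
    wSw-pos = from-⌊⌋ (0ℚ <? wSw u) (proj₁ wSw-bounds)

    wSw<U/2 : wSw u < U/2
    wSw<U/2 = from-⌊⌋ (wSw u <? U/2) (proj₂ wSw-bounds)

    θ-bounds : 0ℚ ≤ θ u × wSw u * θ u ≤ vTr u + vPen u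
    θ-bounds = by-cases (U/2 ≤? Nfree u) (U/2 ≤? Nfree u + wTr u)
      where
      Bounds : ℚ → Set
      Bounds z = 0ℚ ≤ z × wSw u * z ≤ vTr u + vPen u
      vTr≥0 = vOf-nonNeg (inTr u)
      vPen≥0 = vOf-nonNeg (inPen u)
      by-ratio : ∀ X → 0ℚ ≤ X → X ≤ vTr u + vPen u → Bounds (X /' U/2)
      by-ratio X 0≤X X≤ = /'-nonNeg 0≤X (<⇒≤ (<-trans wSw-pos wSw<U/2))
                        , ≤-trans (*-/'≤ 0≤X (<⇒≤ wSw-pos) (<⇒≤ wSw<U/2)) X≤
      by-cases : (d₁ : Dec (U/2 ≤ Nfree u)) (d₂ : Dec (U/2 ≤ Nfree u + wTr u)) →
                 Bounds (if ⌊ d₁ ⌋ then 0ℚ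
                         else if ⌊ d₂ ⌋ then ((vTr u /' wTr u) * (U/2 - Nfree u)) /' U/2
                         else (vTr u + (vPen u /' wPen u) * (U/2 - Nfree u - wTr u)) /' U/2)
      by-cases (yes _) _ = ≤-refl , ≤-trans (≤-reflexive (*-zeroʳ (wSw u))) (+-nonNeg vTr≥0 vPen≥0)
      by-cases (no U/2≰N) (yes U/2≤N+wTr) =
        by-ratio _ (*-nonNeg (/'-nonNeg vTr≥0 (wOf-nonNeg (inTr u))) gap≥0)
                   (≤-trans (≤-trans (≤-reflexive (*-comm _ gap)) (*-/'≤ vTr≥0 gap≥0 gap≤wTr)) (p≤p+q vPen≥0))
        where
        gap = U/2 - Nfree u
        gap≥0 : 0ℚ ≤ gap
        gap≥0 = p≤q⇒0≤q-p (<⇒≤ (≰⇒> U/2≰N))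
        gap≤wTr : gap ≤ wTr u
        gap≤wTr = 0≤q-p⇒p≤q (≤-trans (p≤q⇒0≤q-p U/2≤N+wTr)
          (≤-reflexive (solve 3 (λ N W H → (N :+ W) :- H := W :- (H :- N)) refl (Nfree u) (wTr u) U/2)))
      by-cases (no _) (no U/2≰N+wTr) =
        by-ratio _ (+-nonNeg vTr≥0 (*-nonNeg (/'-nonNeg vPen≥0 (wOf-nonNeg (inPen u))) gap≥0))
                   (+-monoʳ-≤ (vTr u) (≤-trans (≤-reflexive (*-comm _ gap)) (*-/'≤ vPen≥0 gap≥0 gap≤wPen)))
        where
        gap = U/2 - Nfree u - wTr u
        gap≥0 : 0ℚ ≤ gap
        gap≥0 = ≤-trans (p≤q⇒0≤q-p (<⇒≤ (≰⇒> U/2≰N+wTr)))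
          (≤-reflexive (solve 3 (λ H N W → H :- (N :+ W) := H :- N :- W) refl U/2 (Nfree u) (wTr u)))
        -- Nfree u = U - (wSw u + wTr u + wPen u) turns gap ≤ wPen u into wSw u ≤ U/2.
        gap≤wPen : gap ≤ wPen u
        gap≤wPen = 0≤q-p⇒p≤q (≤-trans (p≤q⇒0≤q-p (<⇒≤ wSw<U/2)) (≤-reflexive (begin
          U/2 - wSw u
            ≡⟨ solve 4 (λ V a b c → con ½ :* V :- a := c :- (con ½ :* V :- (V :- (a :+ b :+ c)) :- b))
                       refl U (wSw u) (wTr u) (wPen u) ⟩
          wPen u - (U/2 - (U - (wSw u + wTr u + wPen u)) - wTr u)
            ≡⟨ cong (λ z → wPen u - (U/2 - (U - z) - wTr u)) (sumFin-x≡wSw+wTr+wPen u u∈S∖S*) ⟨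
          wPen u - gap ∎)))
          where open ≡-Reasoning

lemma8 : ∀ {nF nC} (I : Instance nF nC)
           (S : FSet nF) (x : Fin nF → Fin nC → ℚ)
           (S* : FSet nF) (x* : Fin nF → Fin nC → ℚ)
           (P : List (WPath nF nC)) →
           IsMinCostAssignment I S x →
           IsOptimalSolution I S* x* →
           IsPathDecomposition I S x S* x* P →
           Σ (Fin nF → Fin nF → ℚ) (λ y →
             Setup.LPFeasible I S x S* x* P y ×
             Setup.objective I S x S* x* P y ≤ Setup.bound I S x S* x* P)
lemma8 I S x S* x* P (x-assignment , _) (x*-assignment , _) pd = R.y , feasible , objective≤bound
  where
  open Instance I
  open IsMetric metric
  open Setup I S x S* x* P
  open Decomposition I S x S* x* P x-assignment x*-assignment pd

  module R = Reassignment isLight S*minusS wst (cFF I) wSw θ fcost vSw (λ u → vTr u + vPen u)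
    light⇒∉S*∖S wst-nonNeg wSw-pos (λ s _ → sumOver-wst≡wSw s)
    (λ s t → nonneg (inj₁ s) (inj₁ t)) (λ s t → symm (inj₁ s) (inj₁ t)) (λ s t u → tri (inj₁ s) (inj₁ t) (inj₁ u))
    fcost≥0 (λ u light → proj₁ (θ-bounds u light)) (λ s _ → sumOver-wst*cFF≤vSw s) (λ u light → proj₂ (θ-bounds u light))

  feasible : LPFeasible R.y
  feasible = record
    { nonneg   = λ s t light _ → R.y-nonNeg s t light
    ; rowSum   = R.y-rowSum
    ; colSum   = R.y-colSum
    ; diagZero = R.y-diag
    }

  objective≤bound : objective R.y ≤ bound
  objective≤bound = ≤-trans R.objective≤ (≤-reflexive bound-by-light-sums)
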